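{- Let $u$ be a positive integer and let $H_u$ be a normalised $u\times u$ Hadamard matrix. Put $$H_{2u}=\begin{pmatrix} H_u & H_u\\ H_u & -H_u\end{pmatrix},$$ a normalised $2u\times 2u$ Hadamard matrix, and let $h_0,h_1,\dots,h_{2u-1}$ be its rows (each a row vector of length $2u$ with entries $\pm1$). For $0\le i\le 2u-1$ let $\tilde A_i$ be the $2u\times 2u$ matrix with $(r,c)$ entry $(h_i)_r(h_i)_c$ and $\tilde S_i$ the $2u\times 2u$ matrix with $(r,c)$ entry $(h_i)_r(h_u)_c$ (that is, $\tilde A_i=h_i\otimes h_i^T$ and $\tilde S_i=h_u\otimes h_i^T$). Let $A_i$ and $S_i$ be the $0/1$ matrices obtained from $\tilde A_i$ and $\tilde S_i$ by replacing every entry $1$ by $0$ and every entry $-1$ by $1$ (so $A_0$ is the $2u\times 2u$ zero matrix). Let $L$ be the $(2u-1)\times(2u-1)$ Latin square on the symbol set $\{0,1,\dots,2u-1\}\setminus\{u\}$ whose first row is $$0,\,1,\,2,\,\dots,\,u-1,\,2u-1,\,2u-2,\,\dots,\,u+2,\,u+1$$ and whose remaining rows are the successive cyclic shifts of this row. Let $L(A)$ be the $(2u-1)\times(2u-1)$ block matrix obtained from $L$ by replacing each symbol $i$ by the matrix $A_i$. Let $P_u$ be the $4u^2\times 4u^2$ $0/1$ block matrix $$P_u=\begin{pmatrix} 0 & S_1 & S_2 & \cdots & S_{2u-1}\\ S_1^T & & & & \\ S_2^T & & L(A) & & \\ \vdots & & & & \\ S_{2u-1}^T & & & & \end{pmatrix},$$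 where the top-left $0$ is the $2u\times 2u$ zero matrix. Then $P_u$ is the incidence matrix (rows = blocks, columns = points) of a pseudo quasi-3 design with parameters $2$-$(4u^2,\,2u^2-u,\,u^2-u)$, and for any three distinct blocks at least one of which is among the first $2u$ blocks (rows) of $P_u$, the size of the common intersection of the three blocks is either $u^2/2-u$ or $u^2/2-u/2$.
   Context: A $2$-$(v,k,\lambda)$ design consists of a set of $v$ points and a collection of $k$-element subsets (blocks) such that every pair of distinct points lies in exactly $\lambda$ blocks; it is symmetric if the number of blocks equals the number of points. The incidence matrix has rows indexed by blocks, columns by points, with entry $1$ iff the point lies in the block. A Hadamard matrix $H$ of order $u$ is a $u\times u$ matrix with entries $\pm1$ and $HH^T=uI$; it is normalised if its first row and first column consist entirely of $1$'s. A pseudo quasi-3 design is a symmetric $2$-design having a specified block $B$ such that the common intersection sizes $|B\cap B'\cap B''|$, over all pairs of distinct blocks $B',B''$ different from $B$, take one of only two distinct values. -}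

module Defs where

open import Data.Nat using (ℕ; zero; suc; _+_; _*_)
open import Data.Integer as ℤ using (ℤ; +_; -_)
open import Data.Fin using (Fin; zero; suc; toℕ; splitAt; remQuot; _↑ˡ_; _↑ʳ_; inject₁; opposite)
open import Data.Nat.DivMod using (_mod_)
open import Data.Sum using (_⊎_; inj₁; inj₂; [_,_])
open import Data.Product using (_×_; _,_; Σ; ∃)
open import Relation.Binary.PropositionalEquality using (_≡_; _≢_)

sumℕ : ∀ {n} → (Fin n → ℕ) → ℕ
sumℕ {zero}  f = 0
sumℕ {suc n} f = f zero + sumℕ (λ i → f (suc i))

sumℤ : ∀ {n} → (Fin n → ℤ) → ℤ
sumℤ {zero}  f = + 0
sumℤ {suc n} f = f zero ℤ.+ sumℤ (λ i → f (suc i))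

IsHadamard : (u : ℕ) → (Fin u → Fin u → ℤ) → Set
IsHadamard u H =
  (∀ i j → H i j ≡ + 1 ⊎ H i j ≡ - (+ 1)) ×
  (∀ i j → i ≡ j → sumℤ (λ k → H i k ℤ.* H j k) ≡ + u) ×
  (∀ i j → i ≢ j → sumℤ (λ k → H i k ℤ.* H j k) ≡ + 0)

-- normalised: first row and first column all 1 (order suc m, so nonempty)
IsNormalised : (m : ℕ) → (Fin (suc m) → Fin (suc m) → ℤ) → Set
IsNormalised m H = ∀ j → H zero j ≡ + 1 × H j zero ≡ + 1

-- Symmetric 2-designs given by a square 0/1 incidence matrix
-- M b p : rows = blocks, columns = points.

IsSymmetric2Design : (v k λ' : ℕ) → (Fin v → Fin v → ℕ) → Set
IsSymmetric2Design v k λ' M =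
  (∀ b p → M b p ≡ 0 ⊎ M b p ≡ 1) ×
  (∀ b → sumℕ (λ p → M b p) ≡ k) ×
  (∀ p q → p ≢ q → sumℕ (λ b → M b p * M b q) ≡ λ')

tripleInt : ∀ {v} → (Fin v → Fin v → ℕ) → Fin v → Fin v → Fin v → ℕ
tripleInt M b₁ b₂ b₃ = sumℕ (λ p → M b₁ p * M b₂ p * M b₃ p)

IsPseudoQuasi3 : (v k λ' : ℕ) → (Fin v → Fin v → ℕ) → Set
IsPseudoQuasi3 v k λ' M =
  IsSymmetric2Design v k λ' M ×
  Σ (Fin v) λ B → Σ ℕ λ x → Σ ℕ λ y →
    ∀ B' B'' → B' ≢ B → B'' ≢ B → B' ≢ B'' →
      tripleInt M B B' B'' ≡ x ⊎ tripleInt M B B' B'' ≡ y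

-- The construction.  Throughout u = suc m, and 2u is written u + u.

module Construction (m : ℕ) (Hu : Fin (suc m) → Fin (suc m) → ℤ) where

  u : ℕ
  u = suc m

  H2 : Fin (u + u) → Fin (u + u) → ℤ
  H2 i r with splitAt u i | splitAt u r
  ... | inj₁ i' | inj₁ r' = Hu i' r'
  ... | inj₁ i' | inj₂ r' = Hu i' r'
  ... | inj₂ i' | inj₁ r' = Hu i' r'
  ... | inj₂ i' | inj₂ r' = - Hu i' r'

  -- replace 1 by 0 and every other entry (i.e. -1) by 1
  bit : ℤ → ℕ
  bit (+ suc zero) = 0
  bit _            = 1

  idxU : Fin (u + u)
  idxU = u ↑ʳ zero

  A : Fin (u + u) → Fin (u + u) → Fin (u + u) → ℕ
  A i r c = bit (H2 i r ℤ.* H2 i c)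

  S : Fin (u + u) → Fin (u + u) → Fin (u + u) → ℕ
  S i r c = bit (H2 i r ℤ.* H2 idxU c)

  -- first row of L: position k ∈ {0,…,2u-2} (note 2u-1 = suc (m + m))
  -- holds k if k < u, and 3u-1-k if k ≥ u.  I.e. 0,1,…,u-1,2u-1,…,u+1.
  firstRow : Fin (suc (m + m)) → Fin (u + u)
  firstRow k = [ (λ x → x ↑ˡ u) , (λ y → u ↑ʳ opposite (inject₁ y)) ] (splitAt u k)

  -- L (t , j) = firstRow ((t + j) mod (2u-1)), t,j ∈ {0,…,2u-2}:
  -- row t is the t-th successive cyclic shift of the first row.
  L : ℕ → ℕ → Fin (u + u)
  L t j = firstRow ((t + j) mod suc (m + m))

  -- P_u as a (2u × 2u)-block matrix, indices (block index, inner index)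
  Pblock : Fin (u + u) × Fin (u + u) → Fin (u + u) × Fin (u + u) → ℕ
  Pblock (zero  , r) (zero  , c) = 0
  Pblock (zero  , r) (suc j , c) = S (suc j) r c
  Pblock (suc t , r) (zero  , c) = S (suc t) c r
  Pblock (suc t , r) (suc j , c) = A (L (toℕ t) (toℕ j)) r c

  -- P_u as a 4u² × 4u² matrix; index I ↦ (I div 2u , I mod 2u)
  P : Fin ((u + u) * (u + u)) → Fin ((u + u) * (u + u)) → ℕ
  P I J = Pblock (remQuot (u + u) I) (remQuot (u + u) J)

module Submission where

-- Write u = m + 1, n = 2u and let h_a (a < n) be the rows of the doubled
-- Hadamard matrix H₂ = [[Hu, Hu], [Hu, -Hu]].  The proof reads P through
-- signs: P = bit ∘ X for a ±1 matrix X of order n² whose block (b, J) is a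
-- scalar multiple of a row of H₂, X b (J, c) = coef b J · h_(row b J) c.
-- Every row sum, inner product and (relevant) triple product of rows of X
-- then reduces, block column by block column, to inner products of rows of
-- H₂; orthogonality of H₂ and three combinatorial properties of the cyclic
-- Latin square L (each row misses only u, contains 0 once, and two rows
-- are related by the half-swap σ in exactly one column) show that X is a
-- regular Hadamard matrix (row sums n) whose triple products through a
-- first-block row are ±n.  A general counting lemma turns such a ±1 matrix
-- into the design parameters and triple intersection sizes.

module FiniteSums where

  open import Defs
  open import Data.Nat as ℕ using (ℕ; zero; suc; _∸_)
  import Data.Nat.Properties as ℕP
  open import Data.Integer as ℤ using (ℤ; +_; -_; _+_; _*_; _-_)
  import Data.Integer.Properties as ℤP
  open import Data.Fin using (Fin; zero; suc; _↑ˡ_; _↑ʳ_; remQuot; inject₁; fromℕ; opposite; toℕ)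
  open import Data.Fin.Properties
    using (splitAt-↑ʳ; remQuot-combine; toℕ-inject₁; toℕ-fromℕ; opposite-prop; opposite-involutive; toℕ-injective;
           toℕ<n; punchInᵢ≢i)
  open import Data.Fin.Permutation using (permutation)
  open import Data.Vec.Functional using (removeAt)
  open import Data.Product using (_×_; _,_; proj₁; proj₂)
  open import Function using (_∘_)
  open import Algebra.Bundles using (AbelianGroup)
  open import Algebra.Properties.Group (AbelianGroup.group ℤP.+-0-abelianGroup) public
    using () renaming (∙-cancelˡ to +-cancelˡ)
  open import Relation.Binary.PropositionalEquality
  open import Algebra.Properties.Semiring.Sum ℤP.+-*-semiring public
    using (sum; sum-syntax; sum-cong-≗; ∑-distrib-+; ∑-comm; *-distribˡ-sum; *-distribʳ-sum;
           sum-replicate-zero; sum-init-last; sum-remove; ∑-permute)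

  sumℤ≡∑ : ∀ {n} (f : Fin n → ℤ) → sumℤ f ≡ ∑[ i < n ] f i
  sumℤ≡∑ {zero}  f = refl
  sumℤ≡∑ {suc n} f = cong (_+_ (f zero)) (sumℤ≡∑ (f ∘ suc))

  sumℕ≡∑ : ∀ {n} (f : Fin n → ℕ) → + sumℕ f ≡ ∑[ i < n ] (+ f i)
  sumℕ≡∑ {zero}  f = refl
  sumℕ≡∑ {suc n} f = trans (ℤP.pos-+ (f zero) (sumℕ (f ∘ suc))) (cong (_+_ (+ f zero)) (sumℕ≡∑ (f ∘ suc)))

  sumℕ-cong : ∀ {n} {f g : Fin n → ℕ} → (∀ i → f i ≡ g i) → sumℕ f ≡ sumℕ g
  sumℕ-cong {zero}  eq = refl
  sumℕ-cong {suc n} eq = cong₂ ℕ._+_ (eq zero) (sumℕ-cong (eq ∘ suc))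

  sumℕ-scaled : ∀ {n} c (f : Fin n → ℕ) → + (c ℕ.* sumℕ f) ≡ ∑[ i < n ] (+ (c ℕ.* f i))
  sumℕ-scaled c f = begin
    + (c ℕ.* sumℕ f)              ≡⟨ ℤP.pos-* c (sumℕ f) ⟩
    + c * + sumℕ f                ≡⟨ cong (_*_ (+ c)) (sumℕ≡∑ f) ⟩
    + c * sum (λ i → + f i)       ≡⟨ *-distribˡ-sum (+ c) (λ i → + f i) ⟩
    sum (λ i → + c * + f i)       ≡⟨ sum-cong-≗ (λ i → sym (ℤP.pos-* c (f i))) ⟩
    sum (λ i → + (c ℕ.* f i))     ∎
    where open ≡-Reasoning

  ∑-ones : ∀ n → ∑[ i < n ] (+ 1) ≡ + n
  ∑-ones zero    = refl
  ∑-ones (suc n) = trans (cong (_+_ (+ 1)) (∑-ones n)) (sym (ℤP.pos-+ 1 n))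

  ∑-neg : ∀ {n} (f : Fin n → ℤ) → ∑[ i < n ] (- f i) ≡ - ∑[ i < n ] f i
  ∑-neg {zero}  f = refl
  ∑-neg {suc n} f = trans (cong (_+_ (- f zero)) (∑-neg (f ∘ suc))) (sym (ℤP.neg-distrib-+ (f zero) _))

  ∑-sub : ∀ {n} (f g : Fin n → ℤ) → ∑[ i < n ] (f i - g i) ≡ ∑[ i < n ] f i - ∑[ i < n ] g i
  ∑-sub f g = trans (∑-distrib-+ f (λ i → - g i)) (cong (_+_ (sum f)) (∑-neg g))

  ∑-factorˡ : ∀ {n} a {f g : Fin n → ℤ} → (∀ i → f i ≡ a * g i) → sum f ≡ a * sum g
  ∑-factorˡ a {f} {g} eq = trans (sum-cong-≗ eq) (sym (*-distribˡ-sum a g))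

  ∑-product : ∀ {a b} (f : Fin a → ℤ) (g : Fin b → ℤ) → sum f * sum g ≡ ∑[ i < a ] ∑[ j < b ] (f i * g j)
  ∑-product f g = trans (*-distribʳ-sum (sum g) f) (sum-cong-≗ (λ i → *-distribˡ-sum (f i) g))

  ∑-vanish : ∀ {n} {f : Fin n → ℤ} → (∀ i → f i ≡ + 0) → sum f ≡ + 0
  ∑-vanish {n} eq = trans (sum-cong-≗ eq) (sum-replicate-zero n)

  ∑-single : ∀ {n} (f : Fin n → ℤ) (k : Fin n) → (∀ i → i ≢ k → f i ≡ + 0) → sum f ≡ f k
  ∑-single {suc n} f k others = begin
    sum f                        ≡⟨ sum-remove {i = k} f ⟩
    f k + sum (removeAt f k)     ≡⟨ cong (_+_ (f k)) (∑-vanish (λ i → others _ (punchInᵢ≢i k i))) ⟩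
    f k + + 0                    ≡⟨ ℤP.+-identityʳ (f k) ⟩
    f k                          ∎
    where open ≡-Reasoning

  ∑-split : ∀ a {b} (f : Fin (a ℕ.+ b) → ℤ) → sum f ≡ ∑[ i < a ] f (i ↑ˡ b) + ∑[ j < b ] f (a ↑ʳ j)
  ∑-split zero    f = sym (ℤP.+-identityˡ _)
  ∑-split (suc a) f = trans (cong (_+_ (f zero)) (∑-split a (f ∘ suc))) (sym (ℤP.+-assoc (f zero) _ _))

  ∑-remQuot : ∀ a b (F : Fin a × Fin b → ℤ) → ∑[ I < a ℕ.* b ] F (remQuot b I) ≡ ∑[ i < a ] ∑[ j < b ] F (i , j)
  ∑-remQuot zero    b F = refl
  ∑-remQuot (suc a) b F = trans (∑-split b (F ∘ remQuot b))
    (cong₂ _+_ (sum-cong-≗ (λ j → cong F (remQuot-combine zero j)))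
               (trans (sum-cong-≗ λ I → cong F (remQuot-step I)) (∑-remQuot a b (λ p → F (suc (proj₁ p) , proj₂ p)))))
    where
    remQuot-step : ∀ I → remQuot {suc a} b (b ↑ʳ I) ≡ (suc (proj₁ (remQuot {a} b I)) , proj₂ (remQuot {a} b I))
    remQuot-step I rewrite splitAt-↑ʳ b (a ℕ.* b) I = refl

  ∑ℕ : ℕ → (ℕ → ℤ) → ℤ
  ∑ℕ k g = ∑[ j < k ] g (toℕ j)

  ∑ℕ-rotate : ∀ k (g : ℕ → ℤ) → g k ≡ g 0 → ∑ℕ k (g ∘ suc) ≡ ∑ℕ k g
  ∑ℕ-rotate k g ends = +-cancelˡ (g 0) _ _ (begin
    g 0 + ∑ℕ k (g ∘ suc)                         ≡⟨ sum-init-last {k} (g ∘ toℕ) ⟩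
    ∑[ j < k ] g (toℕ (inject₁ j)) + g (toℕ (fromℕ k))
       ≡⟨ cong₂ _+_ (sum-cong-≗ {k} (λ j → cong g (toℕ-inject₁ j))) (trans (cong g (toℕ-fromℕ k)) ends) ⟩
    ∑ℕ k g + g 0                                 ≡⟨ ℤP.+-comm (∑ℕ k g) (g 0) ⟩
    g 0 + ∑ℕ k g                                 ∎)
    where open ≡-Reasoning

  ∑ℕ-periodic : ∀ k (g : ℕ → ℤ) → (∀ i → g (i ℕ.+ k) ≡ g i) → ∀ t → ∑ℕ k (λ i → g (t ℕ.+ i)) ≡ ∑ℕ k g
  ∑ℕ-periodic k g period zero    = refl
  ∑ℕ-periodic k g period (suc t) = begin
    ∑ℕ k (λ i → g (suc t ℕ.+ i))       ≡⟨ sum-cong-≗ {k} (λ j → cong g (sym (ℕP.+-suc t (toℕ j)))) ⟩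
    ∑ℕ k (λ i → g (t ℕ.+ suc i))       ≡⟨ ∑ℕ-rotate k (λ i → g (t ℕ.+ i)) (trans (period t) (cong g (sym (ℕP.+-identityʳ t)))) ⟩
    ∑ℕ k (λ i → g (t ℕ.+ i))           ≡⟨ ∑ℕ-periodic k g period t ⟩
    ∑ℕ k g                             ∎
    where open ≡-Reasoning

  ∑-reverse : ∀ k (g : Fin (suc k) → ℤ) → ∑[ y < k ] g (opposite (inject₁ y)) ≡ ∑[ y < k ] g (suc y)
  ∑-reverse k g = trans (sum-cong-≗ (λ y → cong g (opposite-inject₁ y)))
                        (sym (∑-permute (g ∘ suc) (permutation opposite opposite opposite-involutive opposite-involutive)))
    where
    opposite-inject₁ : ∀ (y : Fin k) → opposite (inject₁ y) ≡ suc (opposite y)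
    opposite-inject₁ y = toℕ-injective (begin
      toℕ (opposite (inject₁ y))  ≡⟨ opposite-prop (inject₁ y) ⟩
      k ∸ toℕ (inject₁ y)         ≡⟨ cong (k ∸_) (toℕ-inject₁ y) ⟩
      k ∸ toℕ y                   ≡⟨ ℕP.+-∸-assoc 1 (toℕ<n y) ⟩
      suc (k ∸ suc (toℕ y))       ≡⟨ cong suc (sym (opposite-prop y)) ⟩
      toℕ (suc (opposite y))      ∎)
      where open ≡-Reasoning

module FinSplit where

  open import Data.Nat using (ℕ; _+_)
  open import Data.Fin using (Fin; splitAt; _↑ˡ_; _↑ʳ_)
  open import Data.Fin.Properties using (splitAt-↑ˡ; splitAt-↑ʳ; splitAt⁻¹-↑ˡ; splitAt⁻¹-↑ʳ)
  open import Data.Sum using (inj₁; inj₂)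
  open import Relation.Binary.PropositionalEquality

  data Split (a b : ℕ) : Fin (a + b) → Set where
    left  : (i : Fin a) → Split a b (i ↑ˡ b)
    right : (j : Fin b) → Split a b (a ↑ʳ j)

  split : ∀ a b (k : Fin (a + b)) → Split a b k
  split a b k with splitAt a k in eq
  ... | inj₁ i = subst (Split a b) (splitAt⁻¹-↑ˡ eq) (left i)
  ... | inj₂ j = subst (Split a b) (splitAt⁻¹-↑ʳ eq) (right j)

  left≢right : ∀ {a b} (i : Fin a) (j : Fin b) → i ↑ˡ b ≢ a ↑ʳ j
  left≢right {a} {b} i j eq with trans (sym (splitAt-↑ˡ a i b)) (trans (cong (splitAt a) eq) (splitAt-↑ʳ a b j))
  ... | ()

module SignPatterns where

  open import Defs
  open FiniteSums
  open import Data.Nat as ℕ using (ℕ; NonZero)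
  import Data.Nat.Properties as ℕP
  import Data.Nat.Tactic.RingSolver as ℕ-Solver
  open import Data.Integer as ℤ using (ℤ; +_; -_; _+_; _*_; _-_)
  import Data.Integer.Properties as ℤP
  open import Data.Integer.Tactic.RingSolver using (solve-∀)
  open import Data.Fin using (Fin)
  open import Data.Product using (_,_)
  open import Data.Sum using (_⊎_; inj₁; inj₂)
  open import Relation.Binary.PropositionalEquality

  PM1 : ℤ → Set
  PM1 x = x ≡ + 1 ⊎ x ≡ - + 1

  pm1-* : ∀ {x y} → PM1 x → PM1 y → PM1 (x * y)
  pm1-* (inj₁ refl) (inj₁ refl) = inj₁ refl
  pm1-* (inj₁ refl) (inj₂ refl) = inj₂ refl
  pm1-* (inj₂ refl) (inj₁ refl) = inj₂ refl
  pm1-* (inj₂ refl) (inj₂ refl) = inj₁ refl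

  pm1-sq : ∀ {x} → PM1 x → x * x ≡ + 1
  pm1-sq (inj₁ refl) = refl
  pm1-sq (inj₂ refl) = refl

  PMn : ℕ → ℤ → Set
  PMn n x = x ≡ + n ⊎ x ≡ - + n

  pm1-scale : ∀ {w} n → PM1 w → PMn n (w * + n)
  pm1-scale n (inj₁ refl) = inj₁ (ℤP.*-identityˡ (+ n))
  pm1-scale n (inj₂ refl) = inj₂ (trans (sym (ℤP.neg-distribˡ-* (+ 1) (+ n))) (cong -_ (ℤP.*-identityˡ (+ n))))

  record RegularHadamard (v s : ℕ) (Y : Fin v → Fin v → ℤ) : Set where
    field
      entries    : ∀ i j → PM1 (Y i j)
      rowSum     : ∀ i → ∑[ p < v ] Y i p ≡ + s
      orthogonal : ∀ i j → i ≢ j → ∑[ p < v ] (Y i p * Y j p) ≡ + 0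

  sub-to-ℕ : ∀ {a b v} → + a ≡ + v - + b → a ℕ.+ b ≡ v
  sub-to-ℕ {a} {b} {v} eq = ℤP.+-injective (begin
    + (a ℕ.+ b)       ≡⟨ ℤP.pos-+ a b ⟩
    + a + + b         ≡⟨ cong (_+ + b) eq ⟩
    + v - + b + + b   ≡⟨ sub-add (+ v) (+ b) ⟩
    + v               ∎)
    where
    open ≡-Reasoning
    sub-add : ∀ x y → x - y + y ≡ x
    sub-add = solve-∀

  cancel-scaled : ∀ c {K k s v} .{{_ : NonZero c}} → + (c ℕ.* K) ≡ + v - + s → c ℕ.* k ℕ.+ s ≡ v → K ≡ k
  cancel-scaled c {K} {k} {s} cK ck =
    ℕP.*-cancelˡ-≡ K k c (ℕP.+-cancelʳ-≡ s (c ℕ.* K) (c ℕ.* k) (trans (sub-to-ℕ cK) (sym ck)))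

  module Pattern (bit : ℤ → ℕ) (bit-plus : bit (+ 1) ≡ 0) (bit-minus : bit (- + 1) ≡ 1) where

    bit-01 : ∀ {x} → PM1 x → bit x ≡ 0 ⊎ bit x ≡ 1
    bit-01 (inj₁ refl) = inj₁ bit-plus
    bit-01 (inj₂ refl) = inj₂ bit-minus

    -- The basic identity 2·bit(x) = 1 - x; products of bits follow from it.
    twice-bit : ∀ {x} → PM1 x → + (2 ℕ.* bit x) ≡ + 1 - x
    twice-bit (inj₁ refl) rewrite bit-plus  = refl
    twice-bit (inj₂ refl) rewrite bit-minus = refl

    count₁ : ∀ {v} (F : Fin v → ℤ) → (∀ p → PM1 (F p)) →
      + (2 ℕ.* sumℕ (λ p → bit (F p))) ≡ + v - ∑[ p < v ] F p
    count₁ {v} F pm = begin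
      + (2 ℕ.* sumℕ (λ p → bit (F p)))        ≡⟨ sumℕ-scaled 2 (λ p → bit (F p)) ⟩
      ∑[ p < v ] (+ (2 ℕ.* bit (F p)))        ≡⟨ sum-cong-≗ (λ p → twice-bit (pm p)) ⟩
      ∑[ p < v ] (+ 1 - F p)                  ≡⟨ ∑-sub (λ _ → + 1) F ⟩
      ∑[ p < v ] (+ 1) - ∑[ p < v ] F p       ≡⟨ cong (_- sum F) (∑-ones v) ⟩
      + v - ∑[ p < v ] F p                    ∎
      where open ≡-Reasoning

    four-bits : ∀ {x y} → PM1 x → PM1 y → + (4 ℕ.* (bit x ℕ.* bit y)) ≡ (+ 1 - x) * (+ 1 - y)
    four-bits {x} {y} px py = begin
      + (4 ℕ.* (bit x ℕ.* bit y))              ≡⟨ cong +_ (regroup (bit x) (bit y)) ⟩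
      + (2 ℕ.* bit x ℕ.* (2 ℕ.* bit y))        ≡⟨ ℤP.pos-* (2 ℕ.* bit x) (2 ℕ.* bit y) ⟩
      + (2 ℕ.* bit x) * + (2 ℕ.* bit y)        ≡⟨ cong₂ _*_ (twice-bit px) (twice-bit py) ⟩
      (+ 1 - x) * (+ 1 - y)                    ∎
      where
      open ≡-Reasoning
      regroup : ∀ a b → 4 ℕ.* (a ℕ.* b) ≡ 2 ℕ.* a ℕ.* (2 ℕ.* b)
      regroup = ℕ-Solver.solve-∀

    eight-bits : ∀ {x y z} → PM1 x → PM1 y → PM1 z →
      + (8 ℕ.* (bit x ℕ.* bit y ℕ.* bit z)) ≡ (+ 1 - x) * (+ 1 - y) * (+ 1 - z)
    eight-bits {x} {y} {z} px py pz = begin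
      + (8 ℕ.* (bit x ℕ.* bit y ℕ.* bit z))              ≡⟨ cong +_ (regroup (bit x) (bit y) (bit z)) ⟩
      + (4 ℕ.* (bit x ℕ.* bit y) ℕ.* (2 ℕ.* bit z))      ≡⟨ ℤP.pos-* (4 ℕ.* (bit x ℕ.* bit y)) (2 ℕ.* bit z) ⟩
      + (4 ℕ.* (bit x ℕ.* bit y)) * + (2 ℕ.* bit z)      ≡⟨ cong₂ _*_ (four-bits px py) (twice-bit pz) ⟩
      (+ 1 - x) * (+ 1 - y) * (+ 1 - z)                  ∎
      where
      open ≡-Reasoning
      regroup : ∀ a b c → 8 ℕ.* (a ℕ.* b ℕ.* c) ≡ 4 ℕ.* (a ℕ.* b) ℕ.* (2 ℕ.* c)
      regroup = ℕ-Solver.solve-∀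

    count₂ : ∀ {v} (F G : Fin v → ℤ) → (∀ p → PM1 (F p)) → (∀ p → PM1 (G p)) →
      + (4 ℕ.* sumℕ (λ p → bit (F p) ℕ.* bit (G p))) ≡ + v - sum F - sum G + ∑[ p < v ] (F p * G p)
    count₂ {v} F G pF pG = begin
      + (4 ℕ.* sumℕ (λ p → bit (F p) ℕ.* bit (G p)))
        ≡⟨ sumℕ-scaled 4 (λ p → bit (F p) ℕ.* bit (G p)) ⟩
      sum (λ p → + (4 ℕ.* (bit (F p) ℕ.* bit (G p))))
        ≡⟨ sum-cong-≗ (λ p → trans (four-bits (pF p) (pG p)) (expand (F p) (G p))) ⟩
      sum (λ p → + 1 - F p - G p + F p * G p)
        ≡⟨ ∑-distrib-+ (λ p → + 1 - F p - G p) FG ⟩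
      sum (λ p → + 1 - F p - G p) + sum FG
        ≡⟨ cong (_+ sum FG) (trans (∑-sub (λ p → + 1 - F p) G) (cong (_- sum G) (trans (∑-sub (λ _ → + 1) F) (cong (_- sum F) (∑-ones v))))) ⟩
      + v - sum F - sum G + sum (λ p → F p * G p)
        ∎
      where
      open ≡-Reasoning
      FG : Fin v → ℤ
      FG p = F p * G p
      expand : ∀ x y → (+ 1 - x) * (+ 1 - y) ≡ + 1 - x - y + x * y
      expand = solve-∀

    count₃ : ∀ {v} (F G H : Fin v → ℤ) → (∀ p → PM1 (F p)) → (∀ p → PM1 (G p)) → (∀ p → PM1 (H p)) →
      + (8 ℕ.* sumℕ (λ p → bit (F p) ℕ.* bit (G p) ℕ.* bit (H p))) ≡
      + v - sum F - sum G - sum H + ∑[ p < v ] (F p * G p) + ∑[ p < v ] (F p * H p) + ∑[ p < v ] (G p * H p)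
        - ∑[ p < v ] (F p * G p * H p)
    count₃ {v} F G H pF pG pH = begin
      + (8 ℕ.* sumℕ (λ p → bit (F p) ℕ.* bit (G p) ℕ.* bit (H p)))
        ≡⟨ sumℕ-scaled 8 (λ p → bit (F p) ℕ.* bit (G p) ℕ.* bit (H p)) ⟩
      sum (λ p → + (8 ℕ.* (bit (F p) ℕ.* bit (G p) ℕ.* bit (H p))))
        ≡⟨ sum-cong-≗ (λ p → trans (eight-bits (pF p) (pG p) (pH p)) (expand (F p) (G p) (H p))) ⟩
      sum (λ p → + 1 - F p - G p - H p + F p * G p + F p * H p + G p * H p - F p * G p * H p)
        ≡⟨ linearity ⟩
      + v - sum F - sum G - sum H + sum (λ p → F p * G p) + sum (λ p → F p * H p) + sum (λ p → G p * H p)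
        - sum (λ p → F p * G p * H p)
        ∎
      where
      open ≡-Reasoning
      expand : ∀ x y z → (+ 1 - x) * (+ 1 - y) * (+ 1 - z) ≡ + 1 - x - y - z + x * y + x * z + y * z - x * y * z
      expand = solve-∀
      FG FH GH FGH : Fin v → ℤ
      FG p = F p * G p
      FH p = F p * H p
      GH p = G p * H p
      FGH p = F p * G p * H p
      linearity : sum (λ p → + 1 - F p - G p - H p + FG p + FH p + GH p - FGH p) ≡
                  + v - sum F - sum G - sum H + sum FG + sum FH + sum GH - sum FGH
      linearity =
        trans (∑-sub (λ p → + 1 - F p - G p - H p + FG p + FH p + GH p) FGH) (cong (_- sum FGH)
        (trans (∑-distrib-+ (λ p → + 1 - F p - G p - H p + FG p + FH p) GH) (cong (_+ sum GH)
        (trans (∑-distrib-+ (λ p → + 1 - F p - G p - H p + FG p) FH) (cong (_+ sum FH)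
        (trans (∑-distrib-+ (λ p → + 1 - F p - G p - H p) FG) (cong (_+ sum FG)
        (trans (∑-sub (λ p → + 1 - F p - G p) H) (cong (_- sum H)
        (trans (∑-sub (λ p → + 1 - F p) G) (cong (_- sum G)
        (trans (∑-sub (λ _ → + 1) F) (cong (_- sum F) (∑-ones v))))))))))))))

    patternDesign : ∀ {v s} k λ' {Y : Fin v → Fin v → ℤ} {M : Fin v → Fin v → ℕ} →
      RegularHadamard v s Y → (∀ i j → M i j ≡ bit (Y i j)) → (∀ i j → M i j ≡ M j i) →
      2 ℕ.* k ℕ.+ s ≡ v → 4 ℕ.* λ' ℕ.+ 2 ℕ.* s ≡ v → IsSymmetric2Design v k λ' M
    patternDesign {v} {s} k λ' {Y} {M} hadamard M-is-bits symmetric 2k+s 4λ+2s = zeroOne , blockSize , pairCount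
      where
      open RegularHadamard hadamard
      zeroOne : ∀ b p → M b p ≡ 0 ⊎ M b p ≡ 1
      zeroOne b p rewrite M-is-bits b p = bit-01 (entries b p)
      blockSize : ∀ b → sumℕ (M b) ≡ k
      blockSize b = cancel-scaled 2 (begin
        + (2 ℕ.* sumℕ (M b))                 ≡⟨ cong (λ x → + (2 ℕ.* x)) (sumℕ-cong (M-is-bits b)) ⟩
        + (2 ℕ.* sumℕ (λ p → bit (Y b p)))   ≡⟨ count₁ (Y b) (entries b) ⟩
        + v - sum (Y b)                      ≡⟨ cong (_-_ (+ v)) (rowSum b) ⟩
        + v - + s                            ∎) 2k+s
        where open ≡-Reasoning
      pairCount : ∀ p q → p ≢ q → sumℕ (λ b → M b p ℕ.* M b q) ≡ λ'
      pairCount p q p≢q = cancel-scaled 4 (begin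
        + (4 ℕ.* sumℕ (λ b → M b p ℕ.* M b q))
          ≡⟨ cong (λ x → + (4 ℕ.* x)) (sumℕ-cong (λ b → cong₂ ℕ._*_ (trans (symmetric b p) (M-is-bits p b))
                                                                      (trans (symmetric b q) (M-is-bits q b)))) ⟩
        + (4 ℕ.* sumℕ (λ b → bit (Y p b) ℕ.* bit (Y q b)))
          ≡⟨ count₂ (Y p) (Y q) (entries p) (entries q) ⟩
        + v - sum (Y p) - sum (Y q) + sum (λ b → Y p b * Y q b)
          ≡⟨ cong₂ (λ x y → + v - x - y + sum (λ b → Y p b * Y q b)) (rowSum p) (rowSum q) ⟩
        + v - + s - + s + sum (λ b → Y p b * Y q b)
          ≡⟨ cong (_+_ (+ v - + s - + s)) (orthogonal p q p≢q) ⟩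
        + v - + s - + s + + 0
          ≡⟨ trans (collect (+ v) (+ s)) (cong (_-_ (+ v)) (sym (ℤP.pos-* 2 s))) ⟩
        + v - + (2 ℕ.* s)                    ∎) 4λ+2s
        where
        open ≡-Reasoning
        collect : ∀ a b → a - b - b + + 0 ≡ a - + 2 * b
        collect = solve-∀

    patternTriple : ∀ {v s} {Y : Fin v → Fin v → ℤ} {M : Fin v → Fin v → ℕ} →
      RegularHadamard v s Y → (∀ i j → M i j ≡ bit (Y i j)) →
      ∀ i j l → i ≢ j → i ≢ l → j ≢ l → PMn s (∑[ p < v ] (Y i p * Y j p * Y l p)) →
      8 ℕ.* tripleInt M i j l ℕ.+ 4 ℕ.* s ≡ v ⊎ 8 ℕ.* tripleInt M i j l ℕ.+ 2 ℕ.* s ≡ v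
    patternTriple {v} {s} {Y} {M} hadamard M-is-bits i j l i≢j i≢l j≢l triple = conclude triple
      where
      open RegularHadamard hadamard
      open ≡-Reasoning
      t : ℕ
      t = tripleInt M i j l
      S₃ : ℤ
      S₃ = ∑[ p < v ] (Y i p * Y j p * Y l p)
      counted : + (8 ℕ.* t) ≡ + v - + s - + s - + s + + 0 + + 0 + + 0 - S₃
      counted = begin
        + (8 ℕ.* t)
          ≡⟨ cong (λ x → + (8 ℕ.* x)) (sumℕ-cong (λ p → cong₂ ℕ._*_ (cong₂ ℕ._*_ (M-is-bits i p) (M-is-bits j p)) (M-is-bits l p))) ⟩
        + (8 ℕ.* sumℕ (λ p → bit (Y i p) ℕ.* bit (Y j p) ℕ.* bit (Y l p)))
          ≡⟨ count₃ (Y i) (Y j) (Y l) (entries i) (entries j) (entries l) ⟩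
        + v - sum (Y i) - sum (Y j) - sum (Y l) + sum (λ p → Y i p * Y j p) + sum (λ p → Y i p * Y l p)
          + sum (λ p → Y j p * Y l p) - S₃
          ≡⟨ cong₂ (λ x y → x + y - S₃)
               (cong₂ _+_ (cong₂ _+_ (cong₂ _-_ (cong₂ _-_ (cong (_-_ (+ v)) (rowSum i)) (rowSum j)) (rowSum l))
                                     (orthogonal i j i≢j)) (orthogonal i l i≢l))
               (orthogonal j l j≢l) ⟩
        + v - + s - + s - + s + + 0 + + 0 + + 0 - S₃ ∎
      conclude : PMn s S₃ → 8 ℕ.* t ℕ.+ 4 ℕ.* s ≡ v ⊎ 8 ℕ.* t ℕ.+ 2 ℕ.* s ≡ v
      conclude (inj₁ S₃≡s) = inj₁ (sub-to-ℕ (begin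
        + (8 ℕ.* t)                                     ≡⟨ counted ⟩
        + v - + s - + s - + s + + 0 + + 0 + + 0 - S₃   ≡⟨ cong (λ x → + v - + s - + s - + s + + 0 + + 0 + + 0 - x) S₃≡s ⟩
        + v - + s - + s - + s + + 0 + + 0 + + 0 - + s  ≡⟨ collect (+ v) (+ s) ⟩
        + v - + 4 * + s                                 ≡⟨ cong (_-_ (+ v)) (sym (ℤP.pos-* 4 s)) ⟩
        + v - + (4 ℕ.* s)                               ∎))
        where
        collect : ∀ a b → a - b - b - b + + 0 + + 0 + + 0 - b ≡ a - + 4 * b
        collect = solve-∀
      conclude (inj₂ S₃≡-s) = inj₂ (sub-to-ℕ (begin
        + (8 ℕ.* t)                                     ≡⟨ counted ⟩
        + v - + s - + s - + s + + 0 + + 0 + + 0 - S₃   ≡⟨ cong (λ x → + v - + s - + s - + s + + 0 + + 0 + + 0 - x) S₃≡-s ⟩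
        + v - + s - + s - + s + + 0 + + 0 + + 0 - - + s ≡⟨ collect (+ v) (+ s) ⟩
        + v - + 2 * + s                                 ≡⟨ cong (_-_ (+ v)) (sym (ℤP.pos-* 2 s)) ⟩
        + v - + (2 ℕ.* s)                               ∎))
        where
        collect : ∀ a b → a - b - b - b + + 0 + + 0 + + 0 - - b ≡ a - + 2 * b
        collect = solve-∀

module HadamardMatrices where

  open import Defs
  open FiniteSums
  open SignPatterns
  open FinSplit
  open import Data.Nat as ℕ using (ℕ; zero; suc)
  import Data.Nat.Properties as ℕP
  open import Data.Integer as ℤ using (ℤ; +_; -_; _+_; _*_; _-_; ∣_∣; -[1+_])
  import Data.Integer.Properties as ℤP
  open import Data.Integer.Tactic.RingSolver using (solve-∀)
  open import Data.Fin using (Fin; zero; suc; splitAt; _↑ˡ_; _↑ʳ_; remQuot; combine; punchIn; punchOut)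
  open import Data.Fin.Properties using (splitAt-↑ˡ; splitAt-↑ʳ; remQuot-combine; punchIn-punchOut) renaming (_≟_ to _≟ᶠ_)
  open import Data.Product using (_,_; uncurry)
  open import Data.Sum using (inj₁; inj₂; [_,_])
  open import Function using (_∘_; id; const; _⟨_⟩_)
  open import Relation.Binary.PropositionalEquality hiding ([_])
  open import Relation.Nullary using (Dec; yes; no; contradiction)

  ∑-squares-zero : ∀ {n} (f : Fin n → ℤ) → ∑[ i < n ] (f i * f i) ≡ + 0 → ∀ i → f i ≡ + 0
  ∑-squares-zero {n} f total i = ℤP.∣i∣≡0⇒i≡0 (square-zero (sumℕ-zero g g-total i))
    where
    square-abs : ∀ x → x * x ≡ + (∣ x ∣ ℕ.* ∣ x ∣)
    square-abs (+ k)    = sym (ℤP.pos-* k k)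
    square-abs -[1+ k ] = refl
    sumℕ-zero : ∀ {n} (g : Fin n → ℕ) → sumℕ g ≡ 0 → ∀ i → g i ≡ 0
    sumℕ-zero g eq zero    = ℕP.m+n≡0⇒m≡0 (g zero) eq
    sumℕ-zero g eq (suc i) = sumℕ-zero (g ∘ suc) (ℕP.m+n≡0⇒n≡0 (g zero) eq) i
    g : Fin n → ℕ
    g j = ∣ f j ∣ ℕ.* ∣ f j ∣
    g-total : sumℕ g ≡ 0
    g-total = ℤP.+-injective (trans (sumℕ≡∑ g) (trans (sum-cong-≗ (λ j → sym (square-abs (f j)))) total))
    square-zero : ∀ {k} → k ℕ.* k ≡ 0 → k ≡ 0
    square-zero {k} eq with ℕP.m*n≡0⇒m≡0∨n≡0 k eq
    ... | inj₁ e = e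
    ... | inj₂ e = e

  ∑-swap₂₂ : ∀ {a b} (T : Fin b → Fin b → Fin a → Fin a → ℤ) →
    ∑[ r < b ] ∑[ s < b ] ∑[ l < a ] ∑[ l' < a ] T r s l l' ≡ ∑[ l < a ] ∑[ l' < a ] ∑[ r < b ] ∑[ s < b ] T r s l l'
  ∑-swap₂₂ T = begin
    sum (λ r → sum (λ s → sum (λ l → sum (λ l' → T r s l l'))))
      ≡⟨ sum-cong-≗ (λ r → ∑-comm (λ s l → sum (λ l' → T r s l l'))) ⟩
    sum (λ r → sum (λ l → sum (λ s → sum (λ l' → T r s l l'))))
      ≡⟨ sum-cong-≗ (λ r → sum-cong-≗ (λ l → ∑-comm (λ s l' → T r s l l'))) ⟩
    sum (λ r → sum (λ l → sum (λ l' → sum (λ s → T r s l l'))))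
      ≡⟨ ∑-comm (λ r l → sum (λ l' → sum (λ s → T r s l l'))) ⟩
    sum (λ l → sum (λ r → sum (λ l' → sum (λ s → T r s l l'))))
      ≡⟨ sum-cong-≗ (λ l → ∑-comm (λ r l' → sum (λ s → T r s l l'))) ⟩
    sum (λ l → sum (λ l' → sum (λ r → sum (λ s → T r s l l'))))
      ∎
    where open ≡-Reasoning

  rowGram : ∀ {a b} → (Fin a → Fin b → ℤ) → Fin a → Fin a → ℤ
  rowGram {b = b} A l l' = ∑[ r < b ] (A l r * A l' r)

  columnGram : ∀ {a b} → (Fin a → Fin b → ℤ) → Fin b → Fin b → ℤ
  columnGram {a = a} A r s = ∑[ l < a ] (A l r * A l s)

  -- Both Gram matrices have the same sum of squared entries:
  -- trace (AᵀA)² = trace (AAᵀ)².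
  gram-squares : ∀ {a b} (A : Fin a → Fin b → ℤ) →
    ∑[ r < b ] ∑[ s < b ] (columnGram A r s * columnGram A r s) ≡ ∑[ l < a ] ∑[ l' < a ] (rowGram A l l' * rowGram A l l')
  gram-squares A = begin
    sum (λ r → sum (λ s → columnGram A r s * columnGram A r s))
      ≡⟨ sum-cong-≗ (λ r → sum-cong-≗ (λ s → ∑-product (λ l → A l r * A l s) (λ l' → A l' r * A l' s))) ⟩
    sum (λ r → sum (λ s → sum (λ l → sum (λ l' → (A l r * A l s) * (A l' r * A l' s)))))
      ≡⟨ ∑-swap₂₂ (λ r s l l' → (A l r * A l s) * (A l' r * A l' s)) ⟩
    sum (λ l → sum (λ l' → sum (λ r → sum (λ s → (A l r * A l s) * (A l' r * A l' s)))))
      ≡⟨ sum-cong-≗ (λ l → sum-cong-≗ (λ l' → trans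
           (sum-cong-≗ (λ r → sum-cong-≗ (λ s → regroup (A l r) (A l s) (A l' r) (A l' s))))
           (sym (∑-product (λ r → A l r * A l' r) (λ s → A l s * A l' s))))) ⟩
    sum (λ l → sum (λ l' → rowGram A l l' * rowGram A l l'))
      ∎
    where
    open ≡-Reasoning
    regroup : ∀ p q p' q' → (p * q) * (p' * q') ≡ (p * p') * (q * q')
    regroup = solve-∀

  -- The transpose of a Hadamard matrix is a Hadamard matrix: comparing the
  -- squared Gram entries shows that the off-diagonal column products vanish.
  transpose-Hadamard : ∀ {u} {H : Fin u → Fin u → ℤ} → IsHadamard u H → IsHadamard u (λ i j → H j i)
  transpose-Hadamard {zero}  _ = (λ ()) , (λ ()) , (λ ())
  transpose-Hadamard {suc k} {H} (entries , rowNorm , rowOrth) =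
    (λ i j → entries j i) ,
    (λ r s r≡s → trans (sumℤ≡∑ (λ l → H l r * H l s)) (subst (λ s → col r s ≡ + u) r≡s (colNorm r))) ,
    (λ r s r≢s → trans (sumℤ≡∑ (λ l → H l r * H l s)) (colOrth r s r≢s))
    where
    open ≡-Reasoning
    u : ℕ
    u = suc k
    col row : Fin u → Fin u → ℤ
    col = columnGram H
    row = rowGram H
    rowIsSumℤ : ∀ l l' → row l l' ≡ sumℤ (λ r → H l r * H l' r)
    rowIsSumℤ l l' = sym (sumℤ≡∑ (λ r → H l r * H l' r))
    colNorm : ∀ r → col r r ≡ + u
    colNorm r = trans (sum-cong-≗ (λ l → pm1-sq (entries l r))) (∑-ones u)
    square : Fin u → ℤ
    square _ = + u * + u
    rowSquares : ∀ l → sum (λ l' → row l l' * row l l') ≡ square l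
    rowSquares l = begin
      sum (λ l' → row l l' * row l l')
        ≡⟨ ∑-single (λ l' → row l l' * row l l') l (λ l' l'≢l → cong (λ x → x * x) (rowIsSumℤ l l' ⟨ trans ⟩ rowOrth l l' (l'≢l ∘ sym))) ⟩
      row l l * row l l
        ≡⟨ cong (λ x → x * x) (rowIsSumℤ l l ⟨ trans ⟩ rowNorm l l refl) ⟩
      + u * + u                          ∎
    off : Fin u → Fin k → ℤ
    off r j = col r (punchIn r j)
    offTotal : sum (λ r → sum (λ j → off r j * off r j)) ≡ + 0
    offTotal = +-cancelˡ (sum square) (sum (λ r → sum (λ j → off r j * off r j))) (+ 0) (begin
      sum square + sum (λ r → sum (λ j → off r j * off r j))
        ≡⟨ sym (∑-distrib-+ square (λ r → sum (λ j → off r j * off r j))) ⟩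
      sum (λ r → + u * + u + sum (λ j → off r j * off r j))
        ≡⟨ sum-cong-≗ (λ r → trans (cong (λ x → x * x + sum (λ j → off r j * off r j)) (sym (colNorm r)))
                                   (sym (sum-remove {i = r} (λ s → col r s * col r s)))) ⟩
      sum (λ r → sum (λ s → col r s * col r s))
        ≡⟨ gram-squares H ⟩
      sum (λ l → sum (λ l' → row l l' * row l l'))
        ≡⟨ sum-cong-≗ rowSquares ⟩
      sum square
        ≡⟨ sym (ℤP.+-identityʳ (sum square)) ⟩
      sum square + + 0  ∎)
    colOrth : ∀ r s → r ≢ s → col r s ≡ + 0
    colOrth r s r≢s = begin
      col r s                                             ≡⟨ cong (col r) (sym (punchIn-punchOut r≢s)) ⟩
      off r (punchOut r≢s)                                ≡⟨ cong (uncurry off) (sym (remQuot-combine r (punchOut r≢s))) ⟩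
      uncurry off (remQuot k (combine r (punchOut r≢s)))
        ≡⟨ ∑-squares-zero (uncurry off ∘ remQuot k) (trans (∑-remQuot u k (λ p → uncurry off p * uncurry off p)) offTotal)
                          (combine r (punchOut r≢s)) ⟩
      + 0                                                 ∎

  module Doubling (m : ℕ) (H : Fin (suc m) → Fin (suc m) → ℤ) where
    open Construction m H using (u; H2)

    -- An index of the doubled matrix is a half (an index of H) and a sign.
    half : Fin (u ℕ.+ u) → Fin u
    half k = [ id , id ] (splitAt u k)

    sign : Fin (u ℕ.+ u) → ℤ
    sign k = [ const (+ 1) , const (- + 1) ] (splitAt u k)

    sign-pm : ∀ k → PM1 (sign k)
    sign-pm k with splitAt u k
    ... | inj₁ _ = inj₁ refl
    ... | inj₂ _ = inj₂ refl

    H2-left : ∀ a c → H2 a (c ↑ˡ u) ≡ H (half a) c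
    H2-left a c rewrite splitAt-↑ˡ u c u with splitAt u a
    ... | inj₁ i = refl
    ... | inj₂ i = refl

    H2-right : ∀ a c → H2 a (u ↑ʳ c) ≡ sign a * H (half a) c
    H2-right a c rewrite splitAt-↑ʳ u u c with splitAt u a
    ... | inj₁ i = sym (ℤP.*-identityˡ (H i c))
    ... | inj₂ i = sym (ℤP.-1*i≡-i (H i c))

    half-left : ∀ i → half (i ↑ˡ u) ≡ i
    half-left i rewrite splitAt-↑ˡ u i u = refl

    half-right : ∀ i → half (u ↑ʳ i) ≡ i
    half-right i rewrite splitAt-↑ʳ u u i = refl

    sign-left : ∀ i → sign (i ↑ˡ u) ≡ + 1
    sign-left i rewrite splitAt-↑ˡ u i u = refl

    sign-right : ∀ i → sign (u ↑ʳ i) ≡ - + 1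
    sign-right i rewrite splitAt-↑ʳ u u i = refl

    opposite-signs : ∀ a b → a ≢ b → half a ≡ half b → sign a * sign b ≡ - + 1
    opposite-signs a b a≢b same with split u u a | split u u b
    ... | left i  | left j  = contradiction (cong (_↑ˡ u) (sym (half-left i) ⟨ trans ⟩ same ⟨ trans ⟩ half-left j)) a≢b
    ... | left i  | right j = cong₂ _*_ (sign-left i) (sign-right j)
    ... | right i | left j  = cong₂ _*_ (sign-right i) (sign-left j)
    ... | right i | right j = contradiction (cong (u ↑ʳ_) (sym (half-right i) ⟨ trans ⟩ same ⟨ trans ⟩ half-right j)) a≢b

    doubled-dot : ∀ a b → ∑[ c < u ℕ.+ u ] (H2 a c * H2 b c) ≡ (+ 1 + sign a * sign b) * ∑[ c < u ] (H (half a) c * H (half b) c)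
    doubled-dot a b = begin
      ∑[ c < u ℕ.+ u ] (H2 a c * H2 b c)
        ≡⟨ ∑-split u (λ c → H2 a c * H2 b c) ⟩
      ∑[ c < u ] (H2 a (c ↑ˡ u) * H2 b (c ↑ˡ u)) + ∑[ c < u ] (H2 a (u ↑ʳ c) * H2 b (u ↑ʳ c))
        ≡⟨ cong₂ _+_ (sum-cong-≗ (λ c → cong₂ _*_ (H2-left a c) (H2-left b c)))
                     (∑-factorˡ (sign a * sign b) (λ c → trans (cong₂ _*_ (H2-right a c) (H2-right b c))
                                                              (regroup (sign a) (sign b) (H (half a) c) (H (half b) c)))) ⟩
      R + sign a * sign b * R
        ≡⟨ factor R (sign a * sign b) ⟩
      (+ 1 + sign a * sign b) * R   ∎
      where
      open ≡-Reasoning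
      R : ℤ
      R = ∑[ c < u ] (H (half a) c * H (half b) c)
      regroup : ∀ s t x y → (s * x) * (t * y) ≡ s * t * (x * y)
      regroup = solve-∀
      factor : ∀ r st → r + st * r ≡ (+ 1 + st) * r
      factor = solve-∀

    doubled-Hadamard : IsHadamard u H → IsHadamard (u ℕ.+ u) H2
    doubled-Hadamard (entries , norm , orth) = entries₂ , norm₂ , orth₂
      where
      entries₂ : ∀ a c → PM1 (H2 a c)
      entries₂ a c with split u u c
      ... | left c'  = subst PM1 (sym (H2-left a c')) (entries (half a) c')
      ... | right c' = subst PM1 (sym (H2-right a c')) (pm1-* (sign-pm a) (entries (half a) c'))
      norm₂ : ∀ a b → a ≡ b → sumℤ (λ c → H2 a c * H2 b c) ≡ + (u ℕ.+ u)
      norm₂ a .a refl = trans (sumℤ≡∑ (λ c → H2 a c * H2 a c)) (trans (sum-cong-≗ (λ c → pm1-sq (entries₂ a c))) (∑-ones (u ℕ.+ u)))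
      orth₂ : ∀ a b → a ≢ b → sumℤ (λ c → H2 a c * H2 b c) ≡ + 0
      orth₂ a b a≢b = trans (sumℤ≡∑ (λ c → H2 a c * H2 b c)) (trans (doubled-dot a b) (vanish (half a ≟ᶠ half b)))
        where
        R : ℤ
        R = ∑[ c < u ] (H (half a) c * H (half b) c)
        vanish : Dec (half a ≡ half b) → (+ 1 + sign a * sign b) * R ≡ + 0
        vanish (yes same)     = cong (_* R) (cong (_+_ (+ 1)) (opposite-signs a b a≢b same))
        vanish (no different) = trans (cong (_*_ (+ 1 + sign a * sign b)) (trans (sym (sumℤ≡∑ (λ c → H (half a) c * H (half b) c))) (orth (half a) (half b) different)))
                                      (ℤP.*-zeroʳ (+ 1 + sign a * sign b))

  doubling-transpose : ∀ m (H : Fin (suc m) → Fin (suc m) → ℤ) a b →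
    Construction.H2 m (λ i j → H j i) a b ≡ Construction.H2 m H b a
  doubling-transpose m H a b with splitAt (suc m) a | splitAt (suc m) b
  ... | inj₁ i | inj₁ j = refl
  ... | inj₁ i | inj₂ j = refl
  ... | inj₂ i | inj₁ j = refl
  ... | inj₂ i | inj₂ j = refl

module Congruences where

  open import Data.Nat as ℕ using (ℕ; zero; suc; _+_; _*_; _∸_; _≤_; _<_; NonZero)
  import Data.Nat.Properties as ℕP
  import Data.Nat.Tactic.RingSolver as ℕ-Solver
  open import Data.Nat.DivMod using (_%_; _/_; m≡m%n+[m/n]*n; %-distribˡ-+; [m+kn]%n≡m%n; m%n<n)
  open import Data.Nat.Divisibility using (_∣_; divides; ∣m+n∣m⇒∣n; ∣m∣n⇒∣m+n; n∣m*n; ∣n⇒∣m*n; ∣1⇒≡1; ∣⇒≤)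
  open import Data.Nat.Coprimality using (Coprime; coprime-divisor) renaming (sym to coprime-sym)
  open import Data.Product using (_×_; _,_; Σ)
  open import Data.Sum using (inj₁; inj₂)
  open import Relation.Binary.PropositionalEquality
  open import Relation.Nullary using (contradiction)

  multiple-below-double : ∀ N {k} → N ∣ k → k ≢ 0 → k < N + N → k ≡ N
  multiple-below-double N (divides zero          k≡0) k≢0 _ = contradiction k≡0 k≢0
  multiple-below-double N (divides (suc zero)    k≡N) _   _ = trans k≡N (ℕP.+-identityʳ N)
  multiple-below-double N (divides (suc (suc q)) k≡_) _ k<2N =
    contradiction (subst (_< N + N) k≡_ k<2N) (ℕP.≤⇒≯ (subst (N + N ≤_) (ℕP.+-assoc N N (q * N)) (ℕP.m≤m+n (N + N) (q * N))))

  -- A sum is the sum of the residues plus a multiple of N, so divisibility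
  -- of a sum by N only depends on the residues of the summands.
  sum-by-residues : ∀ N .{{_ : NonZero N}} x y → x + y ≡ (x % N + y % N) + (x / N + y / N) * N
  sum-by-residues N x y = begin
    x + y                                                ≡⟨ cong₂ _+_ (m≡m%n+[m/n]*n x N) (m≡m%n+[m/n]*n y N) ⟩
    (x % N + x / N * N) + (y % N + y / N * N)            ≡⟨ regroup (x % N) (x / N) (y % N) (y / N) N ⟩
    (x % N + y % N) + (x / N + y / N) * N                ∎
    where
    open ≡-Reasoning
    regroup : ∀ a q b r n → (a + q * n) + (b + r * n) ≡ (a + b) + (q + r) * n
    regroup = ℕ-Solver.solve-∀

  ∣-by-residues : ∀ N .{{_ : NonZero N}} x y → N ∣ x + y → N ∣ x % N + y % N
  ∣-by-residues N x y div =
    ∣m+n∣m⇒∣n (subst (N ∣_) (trans (sum-by-residues N x y) (ℕP.+-comm (x % N + y % N) _)) div) (n∣m*n (x / N + y / N))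

  ∣-from-residues : ∀ N .{{_ : NonZero N}} x y → N ∣ x % N + y % N → N ∣ x + y
  ∣-from-residues N x y div = subst (N ∣_) (sym (sum-by-residues N x y)) (∣m∣n⇒∣m+n div (n∣m*n (x / N + y / N)))

  %-cancelʳ-+ : ∀ d a b j → (a + j) % suc d ≡ (b + j) % suc d → a % suc d ≡ b % suc d
  %-cancelʳ-+ d a b j eq = begin
    a % N                              ≡⟨ shift a ⟩
    ((a + j) % N + (j * d) % N) % N    ≡⟨ cong (λ r → (r + (j * d) % N) % N) eq ⟩
    ((b + j) % N + (j * d) % N) % N    ≡⟨ sym (shift b) ⟩
    b % N                              ∎
    where
    open ≡-Reasoning
    N : ℕ
    N = suc d
    regroup : ∀ x j d → x + j * suc d ≡ (x + j) + j * d
    regroup = ℕ-Solver.solve-∀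
    shift : ∀ x → x % N ≡ ((x + j) % N + (j * d) % N) % N
    shift x = trans (sym ([m+kn]%n≡m%n x j N)) (trans (cong (_% N) (regroup x j d)) (%-distribˡ-+ (x + j) (j * d) N))

  solve-linear : ∀ N .{{_ : NonZero N}} c k w → N ∣ 1 + k * w → Σ ℕ λ j → j < N × N ∣ c + k * j
  solve-linear N c k w inverse =
    r , m%n<n (c * w) N , ∣m+n∣m⇒∣n (subst (N ∣_) (trans expand (ℕP.+-comm (c + k * r) _)) (∣n⇒∣m*n c inverse)) (n∣m*n (k * q))
    where
    r q : ℕ
    r = (c * w) % N
    q = (c * w) / N
    distribute : ∀ c k w → c * (1 + k * w) ≡ c + k * (c * w)
    distribute = ℕ-Solver.solve-∀
    regroup : ∀ c k r q n → c + k * (r + q * n) ≡ (c + k * r) + (k * q) * n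
    regroup = ℕ-Solver.solve-∀
    expand : c * (1 + k * w) ≡ (c + k * r) + (k * q) * N
    expand = trans (distribute c k w) (trans (cong (λ x → c + k * x) (m≡m%n+[m/n]*n (c * w) N)) (regroup c k r q N))

  unique-linear≤ : ∀ N c k {a b} → Coprime k N → a ≤ b → N ∣ c + k * a → N ∣ c + k * b → b < N → a ≡ b
  unique-linear≤ N c k {a} {b} coprime a≤b da db b<N =
    trans (sym (ℕP.+-identityʳ a)) (trans (cong (a +_) (sym gap≡0)) (ℕP.m+[n∸m]≡n a≤b))
    where
    gap : ℕ
    gap = b ∸ a
    decompose : c + k * b ≡ (c + k * a) + k * gap
    decompose = trans (cong (λ x → c + k * x) (sym (ℕP.m+[n∸m]≡n a≤b))) (regroup c k a gap)
      where
      regroup : ∀ c k a g → c + k * (a + g) ≡ (c + k * a) + k * g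
      regroup = ℕ-Solver.solve-∀
    N∣gap : N ∣ gap
    N∣gap = coprime-divisor (coprime-sym coprime) (∣m+n∣m⇒∣n (subst (N ∣_) decompose db) da)
    gap≡0 : gap ≡ 0
    gap≡0 with gap | N∣gap | ℕP.≤-<-trans (ℕP.m∸n≤m b a) b<N
    ... | zero  | _   | _     = refl
    ... | suc g | div | gap<N = contradiction (∣⇒≤ div) (ℕP.<⇒≱ gap<N)

  unique-linear : ∀ N c k {a b} → Coprime k N → N ∣ c + k * a → N ∣ c + k * b → a < N → b < N → a ≡ b
  unique-linear N c k {a} {b} coprime da db a<N b<N with ℕP.≤-total a b
  ... | inj₁ a≤b = unique-linear≤ N c k coprime a≤b da db b<N
  ... | inj₂ b≤a = sym (unique-linear≤ N c k coprime b≤a db da a<N)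

  coprime-2-odd : ∀ m → Coprime 2 (suc (m + m))
  coprime-2-odd m {d} (d∣2 , d∣odd) =
    ∣1⇒≡1 (∣m+n∣m⇒∣n (subst (d ∣_) (ℕP.+-comm 1 (m + m)) d∣odd) (subst (d ∣_) (two-m m) (∣n⇒∣m*n m d∣2)))
    where
    two-m : ∀ m → m * 2 ≡ m + m
    two-m = ℕ-Solver.solve-∀

module LatinSquares where

  open import Defs
  open FiniteSums
  open FinSplit
  open Congruences
  open import Data.Nat as ℕ using (ℕ; zero; suc; _∸_; _≤_; _<_; s≤s)
  import Data.Nat.Properties as ℕP
  import Data.Nat.Tactic.RingSolver as ℕ-Solver
  open import Data.Nat.DivMod using (_mod_; _%_; m%n<n; [m+n]%n≡m%n; m<n⇒m%n≡m)
  open import Data.Nat.Divisibility using (_∣_; ∣-refl; ∣-reflexive; m%n≡0⇒n∣m; n∣m⇒m%n≡0)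
  open import Data.Nat.Coprimality using (1-coprimeTo)
  open import Data.Integer as ℤ using (ℤ; +_; _+_; _-_)
  open import Data.Integer.Tactic.RingSolver using (solve-∀)
  open import Data.Fin using (Fin; zero; suc; toℕ; fromℕ<; splitAt; _↑ˡ_; _↑ʳ_; inject₁; opposite)
  open import Data.Fin.Properties
    using (splitAt-↑ˡ; splitAt-↑ʳ; ↑ˡ-injective; ↑ʳ-injective; toℕ-injective; toℕ-fromℕ<; toℕ<n; toℕ-↑ˡ; toℕ-↑ʳ; toℕ-inject₁; opposite-prop)
  open import Data.Product using (_×_; _,_; Σ)
  open import Data.Sum using ([_,_])
  open import Function using (_∘_)
  open import Relation.Binary.PropositionalEquality hiding ([_])
  open import Relation.Nullary using (¬_; contradiction)

  -- The Latin square L of the construction (it does not depend on Hu, which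
  -- is only a parameter of the module Construction where L is defined).
  module LatinSquare (m : ℕ) (Hu : Fin (suc m) → Fin (suc m) → ℤ) where
    open Construction m Hu using (u; idxU; firstRow; L)

    -- L has order N = 2u - 1; the rows and columns of P after the first
    -- block are indexed by Fin K, where K = N in another normal form.
    N K : ℕ
    N = suc (m ℕ.+ m)
    K = m ℕ.+ suc m

    N≡K : N ≡ K
    N≡K = sym (ℕP.+-suc m m)

    <K⇒<N : ∀ {x} → x < K → x < N
    <K⇒<N {x} = subst (x <_) (sym N≡K)

    σ : Fin (u ℕ.+ u) → Fin (u ℕ.+ u)
    σ k = [ u ↑ʳ_ , _↑ˡ u ] (splitAt u k)

    σ-left : ∀ i → σ (i ↑ˡ u) ≡ u ↑ʳ i
    σ-left i rewrite splitAt-↑ˡ u i u = refl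

    σ-right : ∀ i → σ (u ↑ʳ i) ≡ i ↑ˡ u
    σ-right i rewrite splitAt-↑ʳ u u i = refl

    σ-no-fixed-point : ∀ a → σ a ≢ a
    σ-no-fixed-point a with split u u a
    ... | left i  = λ eq → left≢right i i (sym (trans (sym (σ-left i)) eq))
    ... | right i = λ eq → left≢right i i (trans (sym (σ-right i)) eq)

    σ-idxU : σ idxU ≡ zero
    σ-idxU = σ-right zero

    mirror : Fin m → Fin u
    mirror y = opposite (inject₁ y)

    mirror-value : ∀ y → toℕ (mirror y) ≡ m ∸ toℕ y
    mirror-value y = trans (opposite-prop (inject₁ y)) (cong (m ∸_) (toℕ-inject₁ y))

    firstRow-left : ∀ (x : Fin u) → firstRow (x ↑ˡ m) ≡ x ↑ˡ u
    firstRow-left x rewrite splitAt-↑ˡ u x m = refl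

    firstRow-right : ∀ y → firstRow (u ↑ʳ y) ≡ u ↑ʳ mirror y
    firstRow-right y rewrite splitAt-↑ʳ u m y = refl

    mirror-injective : ∀ y y' → mirror y ≡ mirror y' → y ≡ y'
    mirror-injective y y' eq = Data.Fin.Properties.inject₁-injective
      (trans (sym (Data.Fin.Properties.opposite-involutive _)) (trans (cong opposite eq) (Data.Fin.Properties.opposite-involutive _)))

    firstRow-injective : ∀ a b → firstRow a ≡ firstRow b → a ≡ b
    firstRow-injective a b eq with split u m a | split u m b
    ... | left x  | left x'  = cong (_↑ˡ m) (↑ˡ-injective u x x' (trans (sym (firstRow-left x)) (trans eq (firstRow-left x'))))
    ... | left x  | right y' = contradiction (trans (sym (firstRow-left x)) (trans eq (firstRow-right y'))) (left≢right x (mirror y'))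
    ... | right y | left x'  = contradiction (trans (sym (firstRow-left x')) (trans (sym eq) (firstRow-right y))) (left≢right x' (mirror y))
    ... | right y | right y' = cong (u ↑ʳ_) (mirror-injective y y' (↑ʳ-injective u _ _ (trans (sym (firstRow-right y)) (trans eq (firstRow-right y')))))

    firstRow≢idxU : ∀ a → firstRow a ≢ idxU
    firstRow≢idxU a eq with split u m a
    ... | left x  = left≢right x zero (trans (sym (firstRow-left x)) eq)
    ... | right y = contradiction (ℕP.m∸n≡0⇒m≤n (trans (sym (mirror-value y)) (cong toℕ mirror≡0))) (ℕP.<⇒≱ (toℕ<n y))
      where
      mirror≡0 : mirror y ≡ zero
      mirror≡0 = ↑ʳ-injective u (mirror y) zero (trans (sym (firstRow-right y)) eq)

    mirror-sum : ∀ (y : Fin m) → (m ∸ toℕ y) ℕ.+ (u ℕ.+ toℕ y) ≡ N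
    mirror-sum y = begin
      (m ∸ toℕ y) ℕ.+ (u ℕ.+ toℕ y)   ≡⟨ cong ((m ∸ toℕ y) ℕ.+_) (ℕP.+-comm u (toℕ y)) ⟩
      (m ∸ toℕ y) ℕ.+ (toℕ y ℕ.+ u)   ≡⟨ sym (ℕP.+-assoc (m ∸ toℕ y) (toℕ y) u) ⟩
      (m ∸ toℕ y ℕ.+ toℕ y) ℕ.+ u     ≡⟨ cong (ℕ._+ u) (ℕP.m∸n+n≡m (ℕP.<⇒≤ (toℕ<n y))) ⟩
      m ℕ.+ u                         ≡⟨ ℕP.+-suc m m ⟩
      N                               ∎
      where open ≡-Reasoning

    mirror⇒ : ∀ (x : Fin u) (y : Fin m) → x ≡ mirror y → toℕ x ℕ.+ (u ℕ.+ toℕ y) ≡ N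
    mirror⇒ x y refl = trans (cong (ℕ._+ (u ℕ.+ toℕ y)) (mirror-value y)) (mirror-sum y)

    mirror⇐ : ∀ (x : Fin u) (y : Fin m) → toℕ x ℕ.+ (u ℕ.+ toℕ y) ≡ N → x ≡ mirror y
    mirror⇐ x y eq = toℕ-injective (trans (ℕP.+-cancelʳ-≡ (u ℕ.+ toℕ y) (toℕ x) (m ∸ toℕ y) (trans eq (sym (mirror-sum y))))
                                          (sym (mirror-value y)))

    σ-firstRow-left : ∀ (x : Fin u) → σ (firstRow (x ↑ˡ m)) ≡ u ↑ʳ x
    σ-firstRow-left x = trans (cong σ (firstRow-left x)) (σ-left x)

    σ-firstRow-right : ∀ y → σ (firstRow (u ↑ʳ y)) ≡ mirror y ↑ˡ u
    σ-firstRow-right y = trans (cong σ (firstRow-right y)) (σ-right (mirror y))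

    position-left : ∀ (x : Fin u) (y : Fin m) → toℕ (x ↑ˡ m) ℕ.+ toℕ (u ↑ʳ y) ≡ toℕ x ℕ.+ (u ℕ.+ toℕ y)
    position-left x y = cong₂ ℕ._+_ (toℕ-↑ˡ x m) (toℕ-↑ʳ u y)

    position-right : ∀ (x : Fin u) (y : Fin m) → toℕ (u ↑ʳ y) ℕ.+ toℕ (x ↑ˡ m) ≡ toℕ x ℕ.+ (u ℕ.+ toℕ y)
    position-right x y = trans (ℕP.+-comm (toℕ (u ↑ʳ y)) _) (position-left x y)

    flip⇒ : ∀ a b → σ (firstRow a) ≡ firstRow b → toℕ a ℕ.+ toℕ b ≡ N
    flip⇒ a b eq with split u m a | split u m b
    ... | left x  | left x'  = contradiction (trans (sym (firstRow-left x')) (trans (sym eq) (σ-firstRow-left x))) (left≢right x' x)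
    ... | left x  | right y' = trans (position-left x y')
      (mirror⇒ x y' (↑ʳ-injective u x (mirror y') (trans (sym (σ-firstRow-left x)) (trans eq (firstRow-right y')))))
    ... | right y | left x'  = trans (position-right x' y)
      (mirror⇒ x' y (↑ˡ-injective u x' (mirror y) (trans (sym (firstRow-left x')) (trans (sym eq) (σ-firstRow-right y)))))
    ... | right y | right y' = contradiction (trans (sym (σ-firstRow-right y)) (trans eq (firstRow-right y'))) (left≢right (mirror y) (mirror y'))

    flip⇐ : ∀ a b → toℕ a ℕ.+ toℕ b ≡ N → σ (firstRow a) ≡ firstRow b
    flip⇐ a b sum with split u m a | split u m b
    ... | left x  | left x'  = contradiction (trans (sym (cong₂ ℕ._+_ (toℕ-↑ˡ x m) (toℕ-↑ˡ x' m))) sum) (ℕP.<⇒≢ (s≤s small))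
      where
      small : toℕ x ℕ.+ toℕ x' ≤ m ℕ.+ m
      small = ℕP.+-mono-≤ (ℕ.s≤s⁻¹ (toℕ<n x)) (ℕ.s≤s⁻¹ (toℕ<n x'))
    ... | left x  | right y' = trans (σ-firstRow-left x) (trans (cong (u ↑ʳ_) (mirror⇐ x y' (trans (sym (position-left x y')) sum)))
                                                                 (sym (firstRow-right y')))
    ... | right y | left x'  = trans (σ-firstRow-right y) (trans (cong (_↑ˡ u) (sym (mirror⇐ x' y (trans (sym (position-right x' y)) sum))))
                                                                 (sym (firstRow-left x')))
    ... | right y | right y' = contradiction (trans (sym (cong₂ ℕ._+_ (toℕ-↑ʳ u y) (toℕ-↑ʳ u y'))) sum) (ℕP.>⇒≢ (s≤s large))
      where
      large : N ≤ (m ℕ.+ toℕ y) ℕ.+ (u ℕ.+ toℕ y')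
      large = subst (_≤ (m ℕ.+ toℕ y) ℕ.+ (u ℕ.+ toℕ y')) (ℕP.+-suc m m) (ℕP.+-mono-≤ (ℕP.m≤m+n m (toℕ y)) (ℕP.m≤m+n u (toℕ y')))

    toℕ-mod : ∀ k → toℕ (k mod N) ≡ k % N
    toℕ-mod k = toℕ-fromℕ< (m%n<n k N)

    L-residue : ∀ {x y x' y'} → L x y ≡ L x' y' → (x ℕ.+ y) % N ≡ (x' ℕ.+ y') % N
    L-residue {x} {y} {x'} {y'} eq =
      trans (sym (toℕ-mod (x ℕ.+ y))) (trans (cong toℕ (firstRow-injective _ _ eq)) (toℕ-mod (x' ℕ.+ y')))

    L-symmetric : ∀ x y → L x y ≡ L y x
    L-symmetric x y = cong (λ k → firstRow (k mod N)) (ℕP.+-comm x y)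

    L≢idxU : ∀ x y → L x y ≢ idxU
    L≢idxU x y = firstRow≢idxU ((x ℕ.+ y) mod N)

    L-zero⇒ : ∀ x y → L x y ≡ zero → N ∣ x ℕ.+ y
    L-zero⇒ x y eq = m%n≡0⇒n∣m (x ℕ.+ y) N (trans (sym (toℕ-mod (x ℕ.+ y))) (cong toℕ (firstRow-injective _ zero eq)))

    L-zero⇐ : ∀ x y → N ∣ x ℕ.+ y → L x y ≡ zero
    L-zero⇐ x y div = cong firstRow (toℕ-injective {j = zero} (trans (toℕ-mod (x ℕ.+ y)) (n∣m⇒m%n≡0 (x ℕ.+ y) N div)))

    L-column-injective : ∀ {x x'} y → x < N → x' < N → L x y ≡ L x' y → x ≡ x'
    L-column-injective {x} {x'} y x<N x'<N eq =
      trans (sym (m<n⇒m%n≡m x<N)) (trans (%-cancelʳ-+ (m ℕ.+ m) x x' y (L-residue {x} {y} {x'} {y} eq)) (m<n⇒m%n≡m x'<N))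

    regroup-pair : ∀ x x' y → (x ℕ.+ y) ℕ.+ (x' ℕ.+ y) ≡ (x ℕ.+ x') ℕ.+ 2 ℕ.* y
    regroup-pair = ℕ-Solver.solve-∀

    L-flip⇒ : ∀ x x' y → σ (L x y) ≡ L x' y → N ∣ (x ℕ.+ x') ℕ.+ 2 ℕ.* y
    L-flip⇒ x x' y eq = subst (N ∣_) (regroup-pair x x' y) (∣-from-residues N (x ℕ.+ y) (x' ℕ.+ y) (subst (N ∣_) residues ∣-refl))
      where
      residues : N ≡ (x ℕ.+ y) % N ℕ.+ (x' ℕ.+ y) % N
      residues = trans (sym (flip⇒ ((x ℕ.+ y) mod N) ((x' ℕ.+ y) mod N) eq)) (cong₂ ℕ._+_ (toℕ-mod (x ℕ.+ y)) (toℕ-mod (x' ℕ.+ y)))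

    L-flip⇐ : ∀ {x x'} y → x < N → x' < N → x ≢ x' → N ∣ (x ℕ.+ x') ℕ.+ 2 ℕ.* y → σ (L x y) ≡ L x' y
    L-flip⇐ {x} {x'} y x<N x'<N x≢x' div = flip⇐ ((x ℕ.+ y) mod N) ((x' ℕ.+ y) mod N) (trans (cong₂ ℕ._+_ (toℕ-mod (x ℕ.+ y)) (toℕ-mod (x' ℕ.+ y))) residues-sum)
      where
      r r' : ℕ
      r = (x ℕ.+ y) % N
      r' = (x' ℕ.+ y) % N
      nonzero : r ℕ.+ r' ≢ 0
      nonzero r+r'≡0 = x≢x' (trans (sym (m<n⇒m%n≡m x<N))
        (trans (%-cancelʳ-+ (m ℕ.+ m) x x' y (trans (ℕP.m+n≡0⇒m≡0 r r+r'≡0) (sym (ℕP.m+n≡0⇒n≡0 r r+r'≡0)))) (m<n⇒m%n≡m x'<N)))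
      residues-sum : r ℕ.+ r' ≡ N
      residues-sum = multiple-below-double N (∣-by-residues N (x ℕ.+ y) (x' ℕ.+ y) (subst (N ∣_) (sym (regroup-pair x x' y)) div))
                       nonzero (ℕP.+-mono-< (m%n<n (x ℕ.+ y) N) (m%n<n (x' ℕ.+ y) N))

    -- The entries of L, indexed as the non-first blocks of P.
    latin : Fin K → Fin K → Fin (u ℕ.+ u)
    latin t j = L (toℕ t) (toℕ j)

    ExactlyOne : (Fin K → Set) → Set
    ExactlyOne P = Σ (Fin K) λ j₀ → P j₀ × (∀ j → j ≢ j₀ → ¬ P j)

    exactly-one : (Q : ℕ → Set) (j₀ : ℕ) → j₀ < N → Q j₀ → (∀ j → j < N → Q j → j ≡ j₀) → ExactlyOne (Q ∘ toℕ)
    exactly-one Q j₀ j₀<N Qj₀ unique =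
      fromℕ< j₀<K , subst Q (sym (toℕ-fromℕ< j₀<K)) Qj₀ ,
      λ j j≢ Qj → j≢ (toℕ-injective (trans (unique (toℕ j) (<K⇒<N (toℕ<n j)) Qj) (sym (toℕ-fromℕ< j₀<K))))
      where
      j₀<K : j₀ < K
      j₀<K = subst (j₀ <_) N≡K j₀<N

    -- 1 and 2 are invertible modulo N: 1·(2m) ≡ -1 and 2·m ≡ -1.
    inverse-of-1 : N ∣ 1 ℕ.+ 1 ℕ.* (m ℕ.+ m)
    inverse-of-1 = ∣-reflexive (identity m)
      where
      identity : ∀ m → suc (m ℕ.+ m) ≡ 1 ℕ.+ 1 ℕ.* (m ℕ.+ m)
      identity = ℕ-Solver.solve-∀

    inverse-of-2 : N ∣ 1 ℕ.+ 2 ℕ.* m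
    inverse-of-2 = ∣-reflexive (identity m)
      where
      identity : ∀ m → suc (m ℕ.+ m) ≡ 1 ℕ.+ 2 ℕ.* m
      identity = ℕ-Solver.solve-∀

    latin-zero-once : ∀ t → ExactlyOne (λ j → latin t j ≡ zero)
    latin-zero-once t = from-solution (solve-linear N (toℕ t) 1 (m ℕ.+ m) inverse-of-1)
      where
      c : ℕ
      c = toℕ t
      one-times : ∀ j → N ∣ c ℕ.+ j → N ∣ c ℕ.+ 1 ℕ.* j
      one-times j = subst (λ k → N ∣ c ℕ.+ k) (sym (ℕP.*-identityˡ j))
      from-solution : Σ ℕ (λ j → j < N × N ∣ c ℕ.+ 1 ℕ.* j) → ExactlyOne (λ j → latin t j ≡ zero)
      from-solution (j₀ , j₀<N , div) =
        exactly-one (λ j → L c j ≡ zero) j₀ j₀<N (L-zero⇐ c j₀ (subst (λ k → N ∣ c ℕ.+ k) (ℕP.*-identityˡ j₀) div))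
          (λ j j<N zero-at-j → unique-linear N c 1 (1-coprimeTo N) (one-times j (L-zero⇒ c j zero-at-j)) div j<N j₀<N)

    latin-flip-once : ∀ {t t'} → t ≢ t' → ExactlyOne (λ j → σ (latin t j) ≡ latin t' j)
    latin-flip-once {t} {t'} t≢t' = from-solution (solve-linear N c 2 m inverse-of-2)
      where
      c : ℕ
      c = toℕ t ℕ.+ toℕ t'
      x<N : toℕ t < N
      x<N = <K⇒<N (toℕ<n t)
      x'<N : toℕ t' < N
      x'<N = <K⇒<N (toℕ<n t')
      from-solution : Σ ℕ (λ j → j < N × N ∣ c ℕ.+ 2 ℕ.* j) → ExactlyOne (λ j → σ (latin t j) ≡ latin t' j)
      from-solution (j₁ , j₁<N , div) =
        exactly-one (λ j → σ (L (toℕ t) j) ≡ L (toℕ t') j) j₁ j₁<N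
          (L-flip⇐ j₁ x<N x'<N (t≢t' ∘ toℕ-injective) div)
          (λ j j<N flip-at-j → unique-linear N c 2 (coprime-2-odd m) (L-flip⇒ (toℕ t) (toℕ t') j flip-at-j) div j<N j₁<N)

    latin-column-injective : ∀ {t t'} j → t ≢ t' → latin t j ≢ latin t' j
    latin-column-injective {t} {t'} j t≢t' eq =
      t≢t' (toℕ-injective (L-column-injective (toℕ j) (<K⇒<N (toℕ<n t)) (<K⇒<N (toℕ<n t')) eq))

    latin-row-sum : ∀ t (f : Fin (u ℕ.+ u) → ℤ) → ∑[ j < K ] f (latin t j) ≡ sum f - f idxU
    latin-row-sum t f = begin
      ∑ℕ K (λ k → g (toℕ t ℕ.+ k))
        ≡⟨ cong (λ n → ∑ℕ n (λ k → g (toℕ t ℕ.+ k))) (sym N≡K) ⟩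
      ∑ℕ N (λ k → g (toℕ t ℕ.+ k))
        ≡⟨ ∑ℕ-periodic N g periodic (toℕ t) ⟩
      ∑ℕ N g
        ≡⟨ sum-cong-≗ (λ k → cong (f ∘ firstRow) (toℕ-injective (trans (toℕ-mod (toℕ k)) (m<n⇒m%n≡m (toℕ<n k))))) ⟩
      ∑[ k < N ] f (firstRow k)
        ≡⟨ ∑-split u (f ∘ firstRow) ⟩
      ∑[ x < u ] f (firstRow (x ↑ˡ m)) + ∑[ y < m ] f (firstRow (u ↑ʳ y))
        ≡⟨ cong₂ _+_ (sum-cong-≗ (λ x → cong f (firstRow-left x)))
                     (trans (sum-cong-≗ (λ y → cong f (firstRow-right y))) (∑-reverse m (λ z → f (u ↑ʳ z)))) ⟩
      ∑[ x < u ] f (x ↑ˡ u) + ∑[ y < m ] f (u ↑ʳ suc y)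
        ≡⟨ insert (∑[ x < u ] f (x ↑ˡ u)) (∑[ y < m ] f (u ↑ʳ suc y)) (f idxU) ⟩
      ∑[ x < u ] f (x ↑ˡ u) + (f idxU + ∑[ y < m ] f (u ↑ʳ suc y)) - f idxU
        ≡⟨ cong (_- f idxU) (sym (∑-split u f)) ⟩
      sum f - f idxU
        ∎
      where
      open ≡-Reasoning
      g : ℕ → ℤ
      g k = f (firstRow (k mod N))
      periodic : ∀ k → g (k ℕ.+ N) ≡ g k
      periodic k = cong (f ∘ firstRow) (toℕ-injective (trans (toℕ-mod (k ℕ.+ N)) (trans ([m+n]%n≡m%n k N) (sym (toℕ-mod k)))))
      insert : ∀ a b c → a + b ≡ a + (c + b) - c
      insert = solve-∀

module DoubledHadamard where

  open import Defs
  open FiniteSums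
  open SignPatterns
  open FinSplit
  open HadamardMatrices
  open LatinSquares
  open import Data.Nat as ℕ using (ℕ; zero; suc)
  open import Data.Integer as ℤ using (ℤ; +_; -_; _+_; _*_; _-_)
  import Data.Integer.Properties as ℤP
  open import Data.Integer.Tactic.RingSolver using (solve-∀)
  open import Data.Fin using (Fin; zero; suc; _↑ˡ_; _↑ʳ_)
  open import Data.Product using (_,_; proj₁; proj₂)
  open import Relation.Binary.PropositionalEquality

  module DoubledRows (m : ℕ) (Hu : Fin (suc m) → Fin (suc m) → ℤ) (had : IsHadamard (suc m) Hu) (norm : IsNormalised m Hu) where
    open Construction m Hu using (u; H2; idxU)
    open Doubling m Hu
    open LatinSquare m Hu using (σ)

    n : ℕ
    n = u ℕ.+ u

    h : Fin n → Fin n → ℤ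
    h = H2

    h-entries : ∀ a c → PM1 (h a c)
    h-entries = proj₁ (doubled-Hadamard had)

    dot : Fin n → Fin n → ℤ
    dot a b = ∑[ c < n ] (h a c * h b c)

    dot-self : ∀ a → dot a a ≡ + n
    dot-self a = trans (sum-cong-≗ (λ c → pm1-sq (h-entries a c))) (∑-ones n)

    dot-distinct : ∀ {a b} → a ≢ b → dot a b ≡ + 0
    dot-distinct {a} {b} a≢b = trans (sym (sumℤ≡∑ (λ c → h a c * h b c))) (proj₂ (proj₂ (doubled-Hadamard had)) a b a≢b)

    -- The columns of H₂ are orthogonal too (H₂ᵀ is the doubling of Huᵀ).
    column-distinct : ∀ {r s} → r ≢ s → ∑[ a < n ] (h a r * h a s) ≡ + 0
    column-distinct {r} {s} r≢s = begin
      ∑[ a < n ] (h a r * h a s)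
        ≡⟨ sum-cong-≗ (λ a → sym (cong₂ _*_ (doubling-transpose m Hu r a) (doubling-transpose m Hu s a))) ⟩
      ∑[ a < n ] (H2ᵀ r a * H2ᵀ s a)
        ≡⟨ sym (sumℤ≡∑ (λ a → H2ᵀ r a * H2ᵀ s a)) ⟩
      sumℤ (λ a → H2ᵀ r a * H2ᵀ s a)
        ≡⟨ proj₂ (proj₂ (Doubling.doubled-Hadamard m (λ i j → Hu j i) (transpose-Hadamard had))) r s r≢s ⟩
      + 0 ∎
      where
      open ≡-Reasoning
      H2ᵀ : Fin n → Fin n → ℤ
      H2ᵀ = Construction.H2 m (λ i j → Hu j i)

    -- The first row of H₂ is all ones (Hu is normalised), so multiplying by
    -- it entrywise changes nothing.
    h-zero : ∀ c → h zero c ≡ + 1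
    h-zero c with split u u c
    ... | left c'  = trans (H2-left zero c') (proj₁ (norm c'))
    ... | right c' = trans (H2-right zero c') (trans (ℤP.*-identityˡ (Hu zero c')) (proj₁ (norm c')))

    times-first-row : ∀ a c → h a c ≡ h a c * h zero c
    times-first-row a c = sym (trans (cong (h a c *_) (h-zero c)) (ℤP.*-identityʳ (h a c)))

    -- Multiplying a row entrywise by row u = (1,…,1,-1,…,-1) swaps its halves.
    half-σ : ∀ a → half (σ a) ≡ half a
    half-σ a with split u u a
    ... | left i  = trans (cong half (LatinSquare.σ-left m Hu i)) (trans (half-right i) (sym (half-left i)))
    ... | right i = trans (cong half (LatinSquare.σ-right m Hu i)) (trans (half-left i) (sym (half-right i)))

    sign-σ : ∀ a → sign (σ a) ≡ - sign a
    sign-σ a with split u u a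
    ... | left i  = trans (cong sign (LatinSquare.σ-left m Hu i)) (trans (sign-right i) (cong -_ (sym (sign-left i))))
    ... | right i = trans (cong sign (LatinSquare.σ-right m Hu i)) (trans (sign-left i) (cong -_ (sym (sign-right i))))

    h-flip : ∀ a c → h idxU c * h a c ≡ h (σ a) c
    h-flip a c with split u u c
    ... | left c' = begin
      h idxU (c' ↑ˡ u) * h a (c' ↑ˡ u)     ≡⟨ cong₂ _*_ (trans (H2-left idxU c') (trans (cong (λ i → Hu i c') (half-right zero)) (proj₁ (norm c'))))
                                                      (H2-left a c') ⟩
      + 1 * Hu (half a) c'                 ≡⟨ trans (ℤP.*-identityˡ _) (cong (λ i → Hu i c') (sym (half-σ a))) ⟩
      Hu (half (σ a)) c'                   ≡⟨ sym (H2-left (σ a) c') ⟩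
      h (σ a) (c' ↑ˡ u)                    ∎
      where open ≡-Reasoning
    ... | right c' = begin
      h idxU (u ↑ʳ c') * h a (u ↑ʳ c')     ≡⟨ cong₂ _*_ (trans (H2-right idxU c') (cong₂ _*_ (sign-right zero)
                                                             (trans (cong (λ i → Hu i c') (half-right zero)) (proj₁ (norm c')))))
                                                      (H2-right a c') ⟩
      - + 1 * + 1 * (sign a * Hu (half a) c')  ≡⟨ negate (sign a) (Hu (half a) c') ⟩
      - sign a * Hu (half a) c'            ≡⟨ cong₂ _*_ (sym (sign-σ a)) (cong (λ i → Hu i c') (sym (half-σ a))) ⟩
      sign (σ a) * Hu (half (σ a)) c'      ≡⟨ sym (H2-right (σ a) c') ⟩
      h (σ a) (u ↑ʳ c')                    ∎
      where
      open ≡-Reasoning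
      negate : ∀ s x → - + 1 * + 1 * (s * x) ≡ - s * x
      negate = solve-∀

module SignMatrices where

  open import Defs
  open FiniteSums
  open SignPatterns
  open FinSplit
  open HadamardMatrices
  open LatinSquares
  open DoubledHadamard
  open import Data.Nat as ℕ using (ℕ; zero; suc)
  open import Data.Integer as ℤ using (ℤ; +_; -_; _+_; _*_; _-_)
  import Data.Integer.Properties as ℤP
  open import Data.Integer.Tactic.RingSolver using (solve-∀)
  open import Data.Fin using (Fin; zero; suc; toℕ)
  open import Data.Fin.Properties using (suc-injective) renaming (_≟_ to _≟ᶠ_)
  open import Data.Product using (_×_; _,_; proj₁; proj₂)
  open import Data.Sum using (inj₁)
  open import Function using (_∘_)
  open import Relation.Binary.PropositionalEquality
  open import Relation.Nullary using (yes; no)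

  -- The ±1 matrix X whose 0/1 pattern is P.  Its entry in block (b, J)
  -- (b a row of P grouped as (block, index), J a block column) is a row
  -- of H₂ times a scalar: X b (J , c) = coef b J · h (row b J) c.
  module SignMatrix (m : ℕ) (Hu : Fin (suc m) → Fin (suc m) → ℤ) (had : IsHadamard (suc m) Hu) (norm : IsNormalised m Hu) where
    open Construction m Hu using (u; idxU; bit; Pblock)
    open LatinSquare m Hu
    open DoubledRows m Hu had norm

    Block : Set
    Block = Fin n × Fin n

    coef : Block → Fin n → ℤ
    coef (zero  , r) zero    = + 1
    coef (zero  , r) (suc j) = h (suc j) r
    coef (suc t , s) zero    = h idxU s
    coef (suc t , s) (suc j) = h (latin t j) s

    row : Block → Fin n → Fin n
    row (zero  , r) zero    = zero
    row (zero  , r) (suc j) = idxU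
    row (suc t , s) zero    = suc t
    row (suc t , s) (suc j) = latin t j

    X : Block → Block → ℤ
    X b (J , c) = coef b J * h (row b J) c

    coef-entries : ∀ b J → PM1 (coef b J)
    coef-entries (zero  , r) zero    = inj₁ refl
    coef-entries (zero  , r) (suc j) = h-entries (suc j) r
    coef-entries (suc t , s) zero    = h-entries idxU s
    coef-entries (suc t , s) (suc j) = h-entries (latin t j) s

    X-entries : ∀ b p → PM1 (X b p)
    X-entries b (J , c) = pm1-* (coef-entries b J) (h-entries (row b J) c)

    X-pattern : ∀ b p → Pblock b p ≡ bit (X b p)
    X-pattern (zero  , r) (zero  , c) = cong bit (sym (trans (ℤP.*-identityˡ (h zero c)) (h-zero c)))
    X-pattern (zero  , r) (suc j , c) = refl
    X-pattern (suc t , s) (zero  , c) = cong bit (ℤP.*-comm (h (suc t) c) (h idxU s))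
    X-pattern (suc t , s) (suc j , c) = refl

    -- ... and P is symmetric because L is.
    Pblock-symmetric : ∀ b p → Pblock b p ≡ Pblock p b
    Pblock-symmetric (zero  , r) (zero  , c) = refl
    Pblock-symmetric (zero  , r) (suc j , c) = refl
    Pblock-symmetric (suc t , s) (zero  , c) = refl
    Pblock-symmetric (suc t , s) (suc j , c) =
      trans (cong (λ l → bit (h l s * h l c)) (L-symmetric (toℕ t) (toℕ j))) (cong bit (ℤP.*-comm (h (latin j t) s) (h (latin j t) c)))

    ∑P : (Block → ℤ) → ℤ
    ∑P F = ∑[ J < n ] ∑[ c < n ] F (J , c)

    ∑P-cong : ∀ {F G} → (∀ p → F p ≡ G p) → ∑P F ≡ ∑P G
    ∑P-cong eq = sum-cong-≗ (λ J → sum-cong-≗ (λ c → eq (J , c)))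

    block-row-sum : ∀ b → ∑P (X b) ≡ ∑[ J < n ] (coef b J * dot (row b J) zero)
    block-row-sum b = sum-cong-≗ (λ J → ∑-factorˡ (coef b J) (λ c → cong (coef b J *_) (times-first-row (row b J) c)))

    block-dot : ∀ b b' → ∑P (λ p → X b p * X b' p) ≡ ∑[ J < n ] (coef b J * coef b' J * dot (row b J) (row b' J))
    block-dot b b' = sum-cong-≗ (λ J → ∑-factorˡ (coef b J * coef b' J)
                       (λ c → regroup (coef b J) (coef b' J) (h (row b J) c) (h (row b' J) c)))
      where
      regroup : ∀ k k' x y → (k * x) * (k' * y) ≡ k * k' * (x * y)
      regroup = solve-∀

    -- Multiplying by a row of the first block (row 0 or row u of H₂) fixes
    -- or flips the symbols.
    twist : Fin n → Fin n → Fin n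
    twist zero    a = a
    twist (suc j) a = σ a

    first-block-row : ∀ r J a c → h (row (zero , r) J) c * h a c ≡ h (twist J a) c
    first-block-row r zero    a c = trans (cong (_* h a c) (h-zero c)) (ℤP.*-identityˡ (h a c))
    first-block-row r (suc j) a c = h-flip a c

    block-triple : ∀ r b b' → ∑P (λ p → X (zero , r) p * X b p * X b' p) ≡
      ∑[ J < n ] (coef (zero , r) J * coef b J * coef b' J * dot (twist J (row b J)) (row b' J))
    block-triple r b b' = sum-cong-≗ (λ J → ∑-factorˡ (coef (zero , r) J * coef b J * coef b' J) (λ c →
      trans (regroup (coef (zero , r) J) (coef b J) (coef b' J) (h (row (zero , r) J) c) (h (row b J) c) (h (row b' J) c))
            (cong (λ z → coef (zero , r) J * coef b J * coef b' J * (z * h (row b' J) c)) (first-block-row r J (row b J) c))))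
      where
      regroup : ∀ k₁ k k' x₁ x y → (k₁ * x₁) * (k * x) * (k' * y) ≡ k₁ * k * k' * ((x₁ * x) * y)
      regroup = solve-∀

    ∑-dot-vanish : ∀ (w : Fin K → ℤ) (α β : Fin K → Fin n) → (∀ j → α j ≢ β j) →
      ∑[ j < K ] (w j * dot (α j) (β j)) ≡ + 0
    ∑-dot-vanish w α β differ = ∑-vanish (λ j → trans (cong (w j *_) (dot-distinct (differ j))) (ℤP.*-zeroʳ (w j)))

    ∑-dot-once : ∀ (w : Fin K → ℤ) (α β : Fin K → Fin n) → (once : ExactlyOne (λ j → α j ≡ β j)) →
      ∑[ j < K ] (w j * dot (α j) (β j)) ≡ w (proj₁ once) * + n
    ∑-dot-once w α β (j₀ , same , differ) = trans
      (∑-single (λ j → w j * dot (α j) (β j)) j₀ (λ j j≢j₀ → trans (cong (w j *_) (dot-distinct (differ j j≢j₀))) (ℤP.*-zeroʳ (w j))))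
      (cong (w j₀ *_) (trans (cong (dot (α j₀)) (sym same)) (dot-self (α j₀))))

    idxU≢zero : idxU ≢ zero
    idxU≢zero eq = left≢right zero zero (sym eq)

    row-sum : ∀ b → ∑P (X b) ≡ + n
    row-sum (zero , r) = begin
      ∑P (X (zero , r))
        ≡⟨ block-row-sum (zero , r) ⟩
      + 1 * dot zero zero + ∑[ j < K ] (h (suc j) r * dot idxU zero)
        ≡⟨ cong₂ _+_ (trans (ℤP.*-identityˡ _) (dot-self zero)) (∑-dot-vanish (λ j → h (suc j) r) (λ _ → idxU) (λ _ → zero) (λ _ → idxU≢zero)) ⟩
      + n + + 0
        ≡⟨ ℤP.+-identityʳ (+ n) ⟩
      + n ∎
      where open ≡-Reasoning
    row-sum (suc t , s) = begin
      ∑P (X (suc t , s))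
        ≡⟨ block-row-sum (suc t , s) ⟩
      h idxU s * dot (suc t) zero + ∑[ j < K ] (h (latin t j) s * dot (latin t j) zero)
        ≡⟨ cong₂ _+_ (trans (cong (h idxU s *_) (dot-distinct {suc t} {zero} λ ())) (ℤP.*-zeroʳ (h idxU s)))
                     (∑-dot-once (λ j → h (latin t j) s) (latin t) (λ _ → zero) once) ⟩
      + 0 + h (latin t j₀) s * + n
        ≡⟨ trans (ℤP.+-identityˡ _) (cong (_* + n) (trans (cong (λ l → h l s) (proj₁ (proj₂ once))) (h-zero s))) ⟩
      + 1 * + n
        ≡⟨ ℤP.*-identityˡ (+ n) ⟩
      + n ∎
      where
      open ≡-Reasoning
      once : ExactlyOne (λ j → latin t j ≡ zero)
      once = latin-zero-once t
      j₀ : Fin K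
      j₀ = proj₁ once

    column-tail : ∀ {r r'} → r ≢ r' → ∑[ j < K ] (h (suc j) r * h (suc j) r') ≡ - + 1
    column-tail {r} {r'} r≢r' = begin
      tail                                   ≡⟨ unfold tail ⟩
      + 1 * + 1 + tail - + 1                 ≡⟨ cong (λ a → a + tail - + 1) (sym (cong₂ _*_ (h-zero r) (h-zero r'))) ⟩
      h zero r * h zero r' + tail - + 1      ≡⟨ cong (_- + 1) (column-distinct r≢r') ⟩
      + 0 - + 1                              ≡⟨ refl ⟩
      - + 1                                  ∎
      where
      open ≡-Reasoning
      tail : ℤ
      tail = ∑[ j < K ] (h (suc j) r * h (suc j) r')
      unfold : ∀ x → x ≡ + 1 * + 1 + x - + 1
      unfold = solve-∀

    orthogonal : ∀ b b' → b ≢ b' → ∑P (λ p → X b p * X b' p) ≡ + 0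
    orthogonal (zero , r) (zero , r') b≢b' = begin
      ∑P (λ p → X (zero , r) p * X (zero , r') p)
        ≡⟨ block-dot (zero , r) (zero , r') ⟩
      + 1 * + 1 * dot zero zero + ∑[ j < K ] (h (suc j) r * h (suc j) r' * dot idxU idxU)
        ≡⟨ cong₂ _+_ (cong (+ 1 * + 1 *_) (dot-self zero)) (sum-cong-≗ (λ j → cong (h (suc j) r * h (suc j) r' *_) (dot-self idxU))) ⟩
      + 1 * + 1 * + n + ∑[ j < K ] (h (suc j) r * h (suc j) r' * + n)
        ≡⟨ cong (_+_ (+ 1 * + 1 * + n)) (trans (sym (*-distribʳ-sum (+ n) (λ j → h (suc j) r * h (suc j) r'))) (cong (_* + n) (column-tail r≢r'))) ⟩
      + 1 * + 1 * + n + - + 1 * + n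
        ≡⟨ cancel (+ n) ⟩
      + 0 ∎
      where
      open ≡-Reasoning
      r≢r' : r ≢ r'
      r≢r' r≡r' = b≢b' (cong (zero ,_) r≡r')
      cancel : ∀ x → + 1 * + 1 * x + - + 1 * x ≡ + 0
      cancel = solve-∀
    orthogonal (zero , r) (suc t , s) _ = begin
      ∑P (λ p → X (zero , r) p * X (suc t , s) p)
        ≡⟨ block-dot (zero , r) (suc t , s) ⟩
      + 1 * h idxU s * dot zero (suc t) + ∑[ j < K ] (h (suc j) r * h (latin t j) s * dot idxU (latin t j))
        ≡⟨ cong₂ _+_ (trans (cong (+ 1 * h idxU s *_) (dot-distinct {zero} {suc t} λ ())) (ℤP.*-zeroʳ (+ 1 * h idxU s)))
                     (∑-dot-vanish (λ j → h (suc j) r * h (latin t j) s) (λ _ → idxU) (latin t) (λ j eq → L≢idxU (toℕ t) (toℕ j) (sym eq))) ⟩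
      + 0 ∎
      where open ≡-Reasoning
    orthogonal (suc t , s) (zero , r) b≢b' =
      trans (∑P-cong (λ p → ℤP.*-comm (X (suc t , s) p) (X (zero , r) p))) (orthogonal (zero , r) (suc t , s) (b≢b' ∘ sym))
    orthogonal (suc t , s) (suc t' , s') b≢b' with t ≟ᶠ t'
    ... | yes refl = begin
      ∑P (λ p → X (suc t , s) p * X (suc t , s') p)
        ≡⟨ block-dot (suc t , s) (suc t , s') ⟩
      h idxU s * h idxU s' * dot (suc t) (suc t) + ∑[ j < K ] (h (latin t j) s * h (latin t j) s' * dot (latin t j) (latin t j))
        ≡⟨ cong₂ _+_ (cong (h idxU s * h idxU s' *_) (dot-self (suc t)))
                     (trans (sum-cong-≗ (λ j → cong (h (latin t j) s * h (latin t j) s' *_) (dot-self (latin t j))))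
                            (sym (*-distribʳ-sum (+ n) (λ j → g (latin t j))))) ⟩
      g idxU * + n + ∑[ j < K ] g (latin t j) * + n
        ≡⟨ cong (λ x → g idxU * + n + x * + n) (trans (latin-row-sum t g) (cong (_- g idxU) (column-distinct s≢s'))) ⟩
      g idxU * + n + (+ 0 - g idxU) * + n
        ≡⟨ cancel (g idxU) (+ n) ⟩
      + 0 ∎
      where
      open ≡-Reasoning
      s≢s' : s ≢ s'
      s≢s' s≡s' = b≢b' (cong (suc t ,_) s≡s')
      g : Fin n → ℤ
      g a = h a s * h a s'
      cancel : ∀ x y → x * y + (+ 0 - x) * y ≡ + 0
      cancel = solve-∀
    ... | no t≢t' = begin
      ∑P (λ p → X (suc t , s) p * X (suc t' , s') p)
        ≡⟨ block-dot (suc t , s) (suc t' , s') ⟩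
      h idxU s * h idxU s' * dot (suc t) (suc t') + ∑[ j < K ] (h (latin t j) s * h (latin t' j) s' * dot (latin t j) (latin t' j))
        ≡⟨ cong₂ _+_ (trans (cong (h idxU s * h idxU s' *_) (dot-distinct (t≢t' ∘ suc-injective))) (ℤP.*-zeroʳ (h idxU s * h idxU s')))
                     (∑-dot-vanish (λ j → h (latin t j) s * h (latin t' j) s') (latin t) (latin t') (λ j → latin-column-injective j t≢t')) ⟩
      + 0 ∎
      where open ≡-Reasoning

    ±n-from : ∀ {x} w → PM1 w → x ≡ w * + n → PMn n x
    ±n-from w pm eq = subst (PMn n) (sym eq) (pm1-scale n pm)

    triple : ∀ r b b' → b ≢ b' → PMn n (∑P (λ p → X (zero , r) p * X b p * X b' p))
    triple r (zero , s) (zero , s') _ = inj₁ (begin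
      ∑P (λ p → X (zero , r) p * X (zero , s) p * X (zero , s') p)
        ≡⟨ block-triple r (zero , s) (zero , s') ⟩
      + 1 * + 1 * + 1 * dot zero zero + ∑[ j < K ] (w j * dot (σ idxU) idxU)
        ≡⟨ cong₂ _+_ (cong (+ 1 * + 1 * + 1 *_) (dot-self zero)) (∑-dot-vanish w (λ _ → σ idxU) (λ _ → idxU) (λ _ → σ-no-fixed-point idxU)) ⟩
      + 1 * + 1 * + 1 * + n + + 0
        ≡⟨ simplify (+ n) ⟩
      + n ∎)
      where
      open ≡-Reasoning
      simplify : ∀ x → + 1 * + 1 * + 1 * x + + 0 ≡ x
      simplify = solve-∀
      w : Fin K → ℤ
      w j = h (suc j) r * h (suc j) s * h (suc j) s'
    triple r (zero , s) (suc t , s') _ = ±n-from (w j₀) (pm1-* (pm1-* (h-entries (suc j₀) r) (h-entries (suc j₀) s)) (h-entries (latin t j₀) s')) (begin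
      ∑P (λ p → X (zero , r) p * X (zero , s) p * X (suc t , s') p)
        ≡⟨ block-triple r (zero , s) (suc t , s') ⟩
      + 1 * + 1 * h idxU s' * dot zero (suc t) + ∑[ j < K ] (w j * dot (σ idxU) (latin t j))
        ≡⟨ cong₂ _+_ (trans (cong (+ 1 * + 1 * h idxU s' *_) (dot-distinct {zero} {suc t} λ ())) (ℤP.*-zeroʳ (+ 1 * + 1 * h idxU s')))
                     (∑-dot-once w (λ _ → σ idxU) (latin t) once) ⟩
      + 0 + w j₀ * + n
        ≡⟨ ℤP.+-identityˡ (w j₀ * + n) ⟩
      w j₀ * + n ∎)
      where
      open ≡-Reasoning
      w : Fin K → ℤ
      w j = h (suc j) r * h (suc j) s * h (latin t j) s'
      -- σ u = 0, and 0 occurs exactly once in each row of L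
      once : ExactlyOne (λ j → σ idxU ≡ latin t j)
      once with latin-zero-once t
      ... | j₀ , zero-at-j₀ , elsewhere =
        j₀ , trans σ-idxU (sym zero-at-j₀) , λ j j≢j₀ eq → elsewhere j j≢j₀ (trans (sym eq) σ-idxU)
      j₀ : Fin K
      j₀ = proj₁ once
    triple r (suc t , s) (zero , s') b≢b' =
      subst (PMn n) (∑P-cong (λ p → swap (X (zero , r) p) (X (zero , s') p) (X (suc t , s) p)))
            (triple r (zero , s') (suc t , s) (b≢b' ∘ sym))
      where
      swap : ∀ a b c → a * b * c ≡ a * c * b
      swap = solve-∀
    triple r (suc t , s) (suc t' , s') b≢b' with t ≟ᶠ t'
    ... | yes refl = ±n-from (+ 1 * h idxU s * h idxU s') (pm1-* (pm1-* (inj₁ refl) (h-entries idxU s)) (h-entries idxU s')) (begin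
      ∑P (λ p → X (zero , r) p * X (suc t , s) p * X (suc t , s') p)
        ≡⟨ block-triple r (suc t , s) (suc t , s') ⟩
      + 1 * h idxU s * h idxU s' * dot (suc t) (suc t) + ∑[ j < K ] (w j * dot (σ (latin t j)) (latin t j))
        ≡⟨ cong₂ _+_ (cong (+ 1 * h idxU s * h idxU s' *_) (dot-self (suc t)))
                     (∑-dot-vanish w (σ ∘ latin t) (latin t) (λ j → σ-no-fixed-point (latin t j))) ⟩
      + 1 * h idxU s * h idxU s' * + n + + 0
        ≡⟨ ℤP.+-identityʳ _ ⟩
      + 1 * h idxU s * h idxU s' * + n ∎)
      where
      open ≡-Reasoning
      w : Fin K → ℤ
      w j = h (suc j) r * h (latin t j) s * h (latin t j) s'
    ... | no t≢t' = ±n-from (w j₁) (pm1-* (pm1-* (h-entries (suc j₁) r) (h-entries (latin t j₁) s)) (h-entries (latin t' j₁) s')) (begin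
      ∑P (λ p → X (zero , r) p * X (suc t , s) p * X (suc t' , s') p)
        ≡⟨ block-triple r (suc t , s) (suc t' , s') ⟩
      + 1 * h idxU s * h idxU s' * dot (suc t) (suc t') + ∑[ j < K ] (w j * dot (σ (latin t j)) (latin t' j))
        ≡⟨ cong₂ _+_ (trans (cong (+ 1 * h idxU s * h idxU s' *_) (dot-distinct (t≢t' ∘ suc-injective))) (ℤP.*-zeroʳ (+ 1 * h idxU s * h idxU s')))
                     (∑-dot-once w (σ ∘ latin t) (latin t') once) ⟩
      + 0 + w j₁ * + n
        ≡⟨ ℤP.+-identityˡ (w j₁ * + n) ⟩
      w j₁ * + n ∎)
      where
      open ≡-Reasoning
      w : Fin K → ℤ
      w j = h (suc j) r * h (latin t j) s * h (latin t' j) s'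
      once : ExactlyOne (λ j → σ (latin t j) ≡ latin t' j)
      once = latin-flip-once t≢t'
      j₁ : Fin K
      j₁ = proj₁ once

module PseudoQuasi3Design where

  open import Defs
  open FiniteSums
  open SignPatterns
  open FinSplit
  open HadamardMatrices
  open LatinSquares
  open DoubledHadamard
  open SignMatrices
  open import Data.Nat as ℕ using (ℕ; zero; suc; _+_; _*_; _∸_; _<_; _≤_)
  import Data.Nat.Properties as ℕP
  import Data.Nat.Tactic.RingSolver as ℕ-Solver
  open import Data.Nat.DivMod using (_/_; m*n/n≡m)
  open import Data.Integer as ℤ using (ℤ)
  open import Data.Fin using (Fin; zero; suc; toℕ; remQuot; combine; _↑ʳ_)
  open import Data.Fin.Properties using (combine-remQuot; remQuot-combine; toℕ-↑ʳ)
  open import Data.Product using (_×_; _,_; Σ; uncurry)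
  open import Data.Sum using (_⊎_; inj₁; inj₂)
  open import Function using (_∘_)
  open import Relation.Binary.PropositionalEquality
  open import Relation.Nullary using (contradiction)

  module Arithmetic (m : ℕ) where
    u : ℕ
    u = suc m

    block-size : 2 * (2 * u * u ∸ u) + (u + u) ≡ (u + u) * (u + u)
    block-size = begin
      2 * (2 * u * u ∸ u) + (u + u)      ≡⟨ factor (2 * u * u ∸ u) u ⟩
      2 * ((2 * u * u ∸ u) + u)          ≡⟨ cong (2 *_) (ℕP.m∸n+n≡m (ℕP.m≤n*m u (2 * u))) ⟩
      2 * (2 * u * u)                    ≡⟨ square u ⟩
      (u + u) * (u + u)                  ∎
      where
      open ≡-Reasoning
      factor : ∀ a u → 2 * a + (u + u) ≡ 2 * (a + u)
      factor = ℕ-Solver.solve-∀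
      square : ∀ u → 2 * (2 * u * u) ≡ (u + u) * (u + u)
      square = ℕ-Solver.solve-∀

    pair-count : 4 * (u * u ∸ u) + 2 * (u + u) ≡ (u + u) * (u + u)
    pair-count = begin
      4 * (u * u ∸ u) + 2 * (u + u)      ≡⟨ factor (u * u ∸ u) u ⟩
      4 * ((u * u ∸ u) + u)              ≡⟨ cong (4 *_) (ℕP.m∸n+n≡m (ℕP.m≤m*n u u)) ⟩
      4 * (u * u)                        ≡⟨ square u ⟩
      (u + u) * (u + u)                  ∎
      where
      open ≡-Reasoning
      factor : ∀ a u → 4 * a + 2 * (u + u) ≡ 4 * (a + u)
      factor = ℕ-Solver.solve-∀
      square : ∀ u → 4 * (u * u) ≡ (u + u) * (u + u)
      square = ℕ-Solver.solve-∀

    small-triple : ∀ t → 8 * t + 4 * (u + u) ≡ (u + u) * (u + u) → 2 * t + 2 * u ≡ u * u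
    small-triple t eq = ℕP.*-cancelˡ-≡ (2 * t + 2 * u) (u * u) 4 (trans (expand t u) (trans eq (square u)))
      where
      expand : ∀ t u → 4 * (2 * t + 2 * u) ≡ 8 * t + 4 * (u + u)
      expand = ℕ-Solver.solve-∀
      square : ∀ u → (u + u) * (u + u) ≡ 4 * (u * u)
      square = ℕ-Solver.solve-∀

    large-triple : ∀ t → 8 * t + 2 * (u + u) ≡ (u + u) * (u + u) → 2 * t + u ≡ u * u
    large-triple t eq = ℕP.*-cancelˡ-≡ (2 * t + u) (u * u) 4 (trans (expand t u) (trans eq (square u)))
      where
      expand : ∀ t u → 4 * (2 * t + u) ≡ 8 * t + 2 * (u + u)
      expand = ℕ-Solver.solve-∀
      square : ∀ u → (u + u) * (u + u) ≡ 4 * (u * u)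
      square = ℕ-Solver.solve-∀

  halve : ∀ {t k w} → 2 * t + k ≡ w → t ≡ (w ∸ k) / 2
  halve {t} {k} refl = sym (trans (cong (_/ 2) (trans (ℕP.m+n∸n≡m (2 * t) k) (ℕP.*-comm 2 t))) (m*n/n≡m t 2))

  tripleInt-swap₁₂ : ∀ {v} (M : Fin v → Fin v → ℕ) b₁ b₂ b₃ → tripleInt M b₁ b₂ b₃ ≡ tripleInt M b₂ b₁ b₃
  tripleInt-swap₁₂ M b₁ b₂ b₃ = sumℕ-cong (λ p → swap (M b₁ p) (M b₂ p) (M b₃ p))
    where
    swap : ∀ a b c → a * b * c ≡ b * a * c
    swap = ℕ-Solver.solve-∀

  tripleInt-swap₁₃ : ∀ {v} (M : Fin v → Fin v → ℕ) b₁ b₂ b₃ → tripleInt M b₁ b₂ b₃ ≡ tripleInt M b₃ b₂ b₁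
  tripleInt-swap₁₃ M b₁ b₂ b₃ = sumℕ-cong (λ p → swap (M b₁ p) (M b₂ p) (M b₃ p))
    where
    swap : ∀ a b c → a * b * c ≡ c * b * a
    swap = ℕ-Solver.solve-∀

  module Design (m : ℕ) (Hu : Fin (suc m) → Fin (suc m) → ℤ) (had : IsHadamard (suc m) Hu) (norm : IsNormalised m Hu) where
    open Construction m Hu using (u; P; bit)
    open DoubledRows m Hu had norm using (n)
    open LatinSquare m Hu using (K)
    open SignMatrix m Hu had norm
    open Pattern bit refl refl
    open Arithmetic m using (block-size; pair-count; small-triple; large-triple)

    at : Fin (n * n) → Block
    at = remQuot n

    at-injective : ∀ {I J} → at I ≡ at J → I ≡ J
    at-injective {I} {J} eq = trans (sym (combine-remQuot {n} n I)) (trans (cong (uncurry combine) eq) (combine-remQuot {n} n J))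

    ∑-at : ∀ (F : Block → ℤ) → ∑[ I < n * n ] F (at I) ≡ ∑P F
    ∑-at = ∑-remQuot n n

    Y : Fin (n * n) → Fin (n * n) → ℤ
    Y I J = X (at I) (at J)

    Y-regular : RegularHadamard (n * n) n Y
    Y-regular = record
      { entries    = λ I J → X-entries (at I) (at J)
      ; rowSum     = λ I → trans (∑-at (X (at I))) (row-sum (at I))
      ; orthogonal = λ I J I≢J → trans (∑-at (λ p → X (at I) p ℤ.* X (at J) p)) (orthogonal (at I) (at J) (I≢J ∘ at-injective))
      }

    design : IsSymmetric2Design (n * n) (2 * u * u ∸ u) (u * u ∸ u) P
    design = patternDesign (2 * u * u ∸ u) (u * u ∸ u) Y-regular (λ I J → X-pattern (at I) (at J))
                           (λ I J → Pblock-symmetric (at I) (at J)) block-size pair-count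

    first-block : ∀ b → toℕ b < n → Σ (Fin n) λ r → at b ≡ (zero , r)
    first-block b b<n with split n (K * n) b
    ... | left r  = r , remQuot-combine zero r
    ... | right j = contradiction (subst (_< n) (toℕ-↑ʳ n j) b<n) (ℕP.≤⇒≯ (ℕP.m≤m+n n (toℕ j)))

    -- The two possible sizes u²/2 - u and u²/2 - u/2 of a triple intersection.
    TripleSizes : ℕ → Set
    TripleSizes t = 2 * t + 2 * u ≡ u * u ⊎ 2 * t + u ≡ u * u

    triple-first : ∀ b₁ b₂ b₃ → b₁ ≢ b₂ → b₁ ≢ b₃ → b₂ ≢ b₃ → toℕ b₁ < n → TripleSizes (tripleInt P b₁ b₂ b₃)
    triple-first b₁ b₂ b₃ b₁≢b₂ b₁≢b₃ b₂≢b₃ b₁<n with first-block b₁ b₁<n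
    ... | r , at-b₁ with patternTriple Y-regular (λ I J → X-pattern (at I) (at J)) b₁ b₂ b₃ b₁≢b₂ b₁≢b₃ b₂≢b₃ triple-sum
      where
      triple-sum : PMn n (∑[ p < n * n ] (Y b₁ p ℤ.* Y b₂ p ℤ.* Y b₃ p))
      triple-sum = subst (PMn n) (sym (trans (∑-at (λ p → X (at b₁) p ℤ.* X (at b₂) p ℤ.* X (at b₃) p))
                                            (cong (λ b → ∑P (λ p → X b p ℤ.* X (at b₂) p ℤ.* X (at b₃) p)) at-b₁)))
                         (triple r (at b₂) (at b₃) (b₂≢b₃ ∘ at-injective))
    ... | inj₁ eq = inj₁ (small-triple (tripleInt P b₁ b₂ b₃) eq)
    ... | inj₂ eq = inj₂ (large-triple (tripleInt P b₁ b₂ b₃) eq)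

    triple-any : ∀ b₁ b₂ b₃ → b₁ ≢ b₂ → b₁ ≢ b₃ → b₂ ≢ b₃ → (toℕ b₁ < n ⊎ toℕ b₂ < n ⊎ toℕ b₃ < n) →
      TripleSizes (tripleInt P b₁ b₂ b₃)
    triple-any b₁ b₂ b₃ b₁≢b₂ b₁≢b₃ b₂≢b₃ (inj₁ b₁<n) = triple-first b₁ b₂ b₃ b₁≢b₂ b₁≢b₃ b₂≢b₃ b₁<n
    triple-any b₁ b₂ b₃ b₁≢b₂ b₁≢b₃ b₂≢b₃ (inj₂ (inj₁ b₂<n)) =
      subst TripleSizes (sym (tripleInt-swap₁₂ P b₁ b₂ b₃)) (triple-first b₂ b₁ b₃ (b₁≢b₂ ∘ sym) b₂≢b₃ b₁≢b₃ b₂<n)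
    triple-any b₁ b₂ b₃ b₁≢b₂ b₁≢b₃ b₂≢b₃ (inj₂ (inj₂ b₃<n)) =
      subst TripleSizes (sym (tripleInt-swap₁₃ P b₁ b₂ b₃)) (triple-first b₃ b₂ b₁ (b₂≢b₃ ∘ sym) (b₁≢b₃ ∘ sym) (b₁≢b₂ ∘ sym) b₃<n)

    pseudo-quasi-3 : IsPseudoQuasi3 (n * n) (2 * u * u ∸ u) (u * u ∸ u) P
    pseudo-quasi-3 = design , zero , (u * u ∸ 2 * u) / 2 , (u * u ∸ u) / 2 , λ B' B'' B'≢0 B''≢0 B'≢B'' →
      sizes (triple-first zero B' B'' (B'≢0 ∘ sym) (B''≢0 ∘ sym) B'≢B'' (ℕ.s≤s ℕ.z≤n))
      where
      sizes : ∀ {t} → TripleSizes t → t ≡ (u * u ∸ 2 * u) / 2 ⊎ t ≡ (u * u ∸ u) / 2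
      sizes (inj₁ eq) = inj₁ (halve eq)
      sizes (inj₂ eq) = inj₂ (halve eq)

open import Defs
open import Data.Nat using (ℕ; suc; _+_; _*_; _∸_; _<_)
open import Data.Integer using (ℤ)
open import Data.Fin using (Fin; toℕ)
open import Data.Sum using (_⊎_)
open import Data.Product using (_×_; _,_)
open import Relation.Binary.PropositionalEquality using (_≡_; _≢_)
open PseudoQuasi3Design using (module Design)

mainTheorem1 : (m : ℕ) → (Hu : Fin (suc m) → Fin (suc m) → ℤ) →
    IsHadamard (suc m) Hu → IsNormalised m Hu →
    let u = suc m
        P = Construction.P m Hu
    in IsPseudoQuasi3 ((u + u) * (u + u)) (2 * u * u ∸ u) (u * u ∸ u) P ×
       (∀ b₁ b₂ b₃ → b₁ ≢ b₂ → b₁ ≢ b₃ → b₂ ≢ b₃ →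
         (toℕ b₁ < u + u ⊎ toℕ b₂ < u + u ⊎ toℕ b₃ < u + u) →
         2 * tripleInt P b₁ b₂ b₃ + 2 * u ≡ u * u ⊎
         2 * tripleInt P b₁ b₂ b₃ + u ≡ u * u)
mainTheorem1 m Hu had norm = Design.pseudo-quasi-3 m Hu had norm , Design.triple-any m Hu had norm
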